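{- Let $Q^+(7,2)$ be a non-degenerate hyperbolic quadric of ${\rm PG}(7,2)$. Every partial ovoid of $Q^+(7,2)$ of size $4$ is contained in exactly one ovoid of $Q^+(7,2)$.
   Context: A partial ovoid of $Q^+(7,2)$ is a set of points of the quadric no two of which span a line contained in the quadric. An ovoid of $Q^+(7,2)$ is a set of points of the quadric meeting every generator (solid contained in the quadric) in exactly one point; it has $9$ points. -}

module Defs where

open import Data.Bool using (Bool; true; false; _xor_; _∧_; if_then_else_)
open import Data.Nat using (ℕ; zero; suc)
open import Data.Fin using (Fin; zero; suc; _≤?_)
open import Data.Vec using (Vec; lookup; replicate; zipWith; tabulate)
open import Data.Product using (Σ; ∃; _×_; _,_)
open import Relation.Binary.PropositionalEquality using (_≡_)
open import Relation.Nullary using (¬_; does)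

-- Vectors of V(8,2) = GF(2)^8; GF(2) is modelled by Bool with xor as + and ∧ as ·.
V : Set
V = Vec Bool 8

0V : V
0V = replicate 8 false

_⊕_ : V → V → V
x ⊕ y = zipWith _xor_ x y

_·_ : Bool → V → V
c · x = if c then x else 0V

⨁ : {n : ℕ} → (Fin n → Bool) → Bool
⨁ {zero}  f = false
⨁ {suc n} f = f zero xor ⨁ (λ i → f (suc i))

⨁V : {k : ℕ} → (Fin k → V) → V
⨁V {zero}  f = 0V
⨁V {suc k} f = f zero ⊕ ⨁V (λ i → f (suc i))

lincomb : {k : ℕ} → (Fin k → V) → (Fin k → Bool) → V
lincomb g c = ⨁V (λ i → c i · g i)

LinIndep : {k : ℕ} → (Fin k → V) → Set
LinIndep g = ∀ c → lincomb g c ≡ 0V → ∀ i → c i ≡ false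

InSpan : {k : ℕ} → (Fin k → V) → V → Set
InSpan g x = ∃ λ c → lincomb g c ≡ x

-- A quadratic form on V(8,2):  Q(x) = Σ_{i ≤ j} a_ij x_i x_j
-- (the coefficients a_ij with i > j are ignored).
Coeffs : Set
Coeffs = Fin 8 → Fin 8 → Bool

Q : Coeffs → V → Bool
Q a x = ⨁ λ i → ⨁ λ j →
  if does (i ≤? j) then (a i j ∧ (lookup x i ∧ lookup x j)) else false

B : Coeffs → V → V → Bool
B a x y = Q a (x ⊕ y) xor (Q a x xor Q a y)

-- Non-degenerate: the polar form has trivial radical
-- (for a quadric in PG(7,2), i.e. even vector dimension, this is non-degeneracy).
NonDegenerate : Coeffs → Set
NonDegenerate a = ∀ x → ¬ (x ≡ 0V) → ∃ λ y → B a x y ≡ true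

Generator : Coeffs → (Fin 4 → V) → Set
Generator a g = LinIndep g × (∀ x → InSpan g x → Q a x ≡ false)

-- Hyperbolic: Witt index 4, i.e. the quadric contains a solid.
Hyperbolic : Coeffs → Set
Hyperbolic a = ∃ λ g → Generator a g

-- Points of PG(7,2) are the nonzero vectors of V(8,2).
IsPoint : Coeffs → V → Set
IsPoint a x = ¬ (x ≡ 0V) × Q a x ≡ false

-- The line through distinct points p, q is {p, q, p+q}; it is contained
-- in the quadric iff all three points are singular.
LineInQuadric : Coeffs → V → V → Set
LineInQuadric a p q = Q a p ≡ false × Q a q ≡ false × Q a (p ⊕ q) ≡ false

PartialOvoid4 : Coeffs → (Fin 4 → V) → Set
PartialOvoid4 a p =
  (∀ i → IsPoint a (p i)) ×
  (∀ i j → ¬ (i ≡ j) → ¬ (p i ≡ p j)) ×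
  (∀ i j → ¬ (i ≡ j) → ¬ LineInQuadric a (p i) (p j))

Ovoid : Coeffs → (V → Bool) → Set
Ovoid a O =
  (∀ x → O x ≡ true → IsPoint a x) ×
  (∀ g → Generator a g →
     ∃ λ x → (O x ≡ true × InSpan g x) ×
             (∀ y → O y ≡ true → InSpan g y → y ≡ x))

{-# OPTIONS --safe #-}

-- Character sums over GF(2)⁸ do all the counting.  Nondegeneracy gives
-- (Σₓ (−1)^Q(x))² = 256, and a solid in the quadric fixes the sign: Σₓ (−1)^Q(x) = 16.  The
-- same sums count the singular points non-collinear with all points of an independent partial
-- ovoid of size k; for k = 4, …, 7 there are at least two, so the four given points extend to
-- eight pairwise non-collinear points forming a basis.  In that basis Q is Σ_{i<j} xᵢxⱼ and the
-- partial ovoid is {e₄, …, e₇}.  There {e₀, …, e₇, e₀ + ⋯ + e₇} is an ovoid (a parity count shows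
-- that it meets every solid), and explicit solids show that any ovoid containing e₄, …, e₇ is
-- this one: its points are non-collinear with e₄, …, e₇, which leaves only the ovoid points and
-- e₄ + ⋯ + e₇, and the latter is collinear with e₀.

module Submission where

open import Defs

open import Algebra using (CommutativeRing; CommutativeSemigroup)
open import Data.Bool using (Bool; true; false; _xor_; _∧_; not; if_then_else_)
import Data.Bool.Properties as Boolₚ
open import Data.Bool.Properties
  using ( ¬-not; not-involutive; xor-comm; xor-assoc; xor-identityʳ; xor-same
        ; ∧-zeroʳ; ∧-identityʳ; ∧-distribˡ-xor; ∧-distribʳ-xor; xor-∧-commutativeRing)
open import Data.Fin using (Fin; zero; suc; _≤?_; _↑ʳ_)
open import Data.Fin.Properties using (all?; any?; suc-injective) renaming (_≟_ to _≟ᶠ_)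
open import Data.Integer using (ℤ; +_; 0ℤ; 1ℤ; -1ℤ; _+_; _*_; _≤_; +≤+; ∣_∣)
import Data.Integer as ℤ
import Data.Integer.Properties as ℤₚ
open import Data.Integer.Properties
  using ( abs-*; +-inverseˡ; +-comm; +-identityˡ; +-identityʳ; *-comm; *-assoc; *-identityˡ; *-zeroʳ
        ; *-distribˡ-+; *-distribʳ-+; -1*i≡-i; +-mono-≤; ≤-refl; ≤-reflexive)
open import Data.Integer.Divisibility.Signed using (_∣_; divides; ∣m∣n⇒∣m+n; _∣?_)
open import Data.Nat using (ℕ; zero; suc; z≤n; _/_; _%_; _≡ᵇ_)
import Data.Nat as ℕ
open import Data.Nat.Properties using (<-cmp; <⇒≢; *-mono-<)
open import Data.Product using (∃; _×_; _,_; proj₁; proj₂)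
open import Data.Sum using (_⊎_; inj₁; inj₂; [_,_]′)
open import Data.Vec using (Vec; []; _∷_; _∷ʳ_; lookup; replicate; tabulate; zipWith)
import Data.Vec.Properties as Vecₚ
open import Data.Vec.Properties using (lookup-zipWith; lookup-replicate; lookup∘tabulate; ∷-injectiveʳ)
open import Data.Vec.Relation.Binary.Pointwise.Inductive
  using (Pointwise-≡⇒≡; zipWith-comm; zipWith-assoc; zipWith-identityˡ; zipWith-identityʳ)
open import Data.Vec.Functional using () renaming (_∷_ to _∷ᶠ_)
open import Function using (_∘_)
open import Level using (Level)
open import Relation.Binary using (DecidableEquality; tri<; tri≈; tri>)
open import Relation.Binary.PropositionalEquality
open import Relation.Nullary using (¬_; Dec; yes; no; does; contradiction)
open import Relation.Nullary.Decidable
  using (map′; ¬?; _×-dec_; _⊎-dec_; _→-dec_; dec-true; dec-false; from-yes; from-no)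
open import Relation.Unary using (Pred; Decidable)

open import Algebra.Definitions {A = V} _≡_ using (Commutative; Associative; LeftIdentity; RightIdentity)
open import Algebra.Properties.CommutativeSemigroup
  (CommutativeRing.+-commutativeSemigroup xor-∧-commutativeRing)
  using () renaming (interchange to xor-interchange)
open import Algebra.Properties.CommutativeSemigroup ℤₚ.+-commutativeSemigroup
  using () renaming (interchange to +-interchange)
open import Algebra.Properties.CommutativeSemigroup ℤₚ.*-commutativeSemigroup using (x∙yz≈y∙xz)
open import Algebra.Properties.CommutativeMonoid.Sum ℤₚ.+-0-commutativeMonoid using (sum; sum-cong-≗)

private
  variable
    ℓ : Level
    k n : ℕ

-- GF(2)-linear algebra on V

xor≡false⇒≡ : ∀ b b′ → b xor b′ ≡ false → b ≡ b′
xor≡false⇒≡ false false _ = refl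
xor≡false⇒≡ true  true  _ = refl

⊕-comm : Commutative _⊕_
⊕-comm x y = Pointwise-≡⇒≡ (zipWith-comm xor-comm x y)

⊕-assoc : Associative _⊕_
⊕-assoc x y z = Pointwise-≡⇒≡ (zipWith-assoc xor-assoc x y z)

⊕-identityˡ : LeftIdentity 0V _⊕_
⊕-identityˡ x = Pointwise-≡⇒≡ (zipWith-identityˡ (λ _ → refl) x)

⊕-identityʳ : RightIdentity 0V _⊕_
⊕-identityʳ x = Pointwise-≡⇒≡ (zipWith-identityʳ xor-identityʳ x)

⊕-self : ∀ x → x ⊕ x ≡ 0V
⊕-self = go
  where
  go : (x : Vec Bool n) → zipWith _xor_ x x ≡ replicate n false
  go []      = refl
  go (b ∷ x) = cong₂ _∷_ (xor-same b) (go x)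

⊕-commutativeSemigroup : CommutativeSemigroup _ _
⊕-commutativeSemigroup = record
  { _∙_ = _⊕_
  ; isCommutativeSemigroup = record
    { isSemigroup = record
      { isMagma = record { isEquivalence = isEquivalence ; ∙-cong = cong₂ _⊕_ }
      ; assoc = ⊕-assoc }
    ; comm = ⊕-comm } }

open import Algebra.Properties.CommutativeSemigroup ⊕-commutativeSemigroup
  using () renaming (interchange to ⊕-interchange)

⊕≡0⇒≡ : ∀ {x y} → x ⊕ y ≡ 0V → x ≡ y
⊕≡0⇒≡ {x} {y} x⊕y≡0 = begin
  x              ≡⟨ sym (⊕-identityʳ x) ⟩
  x ⊕ 0V         ≡⟨ cong (x ⊕_) (sym (⊕-self y)) ⟩
  x ⊕ (y ⊕ y)    ≡⟨ sym (⊕-assoc x y y) ⟩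
  (x ⊕ y) ⊕ y    ≡⟨ cong (_⊕ y) x⊕y≡0 ⟩
  0V ⊕ y         ≡⟨ ⊕-identityˡ y ⟩
  y              ∎
  where open ≡-Reasoning

⨁-cong : {f g : Fin n → Bool} → (∀ i → f i ≡ g i) → ⨁ f ≡ ⨁ g
⨁-cong {zero}  f≗g = refl
⨁-cong {suc n} f≗g = cong₂ _xor_ (f≗g zero) (⨁-cong (f≗g ∘ suc))

⨁-xor : (f g : Fin n → Bool) → ⨁ (λ i → f i xor g i) ≡ ⨁ f xor ⨁ g
⨁-xor {zero}  f g = refl
⨁-xor {suc n} f g = trans (cong ((f zero xor g zero) xor_) (⨁-xor (f ∘ suc) (g ∘ suc)))
                          (xor-interchange (f zero) (g zero) (⨁ (f ∘ suc)) (⨁ (g ∘ suc)))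

⨁-false : ⨁ {n} (λ _ → false) ≡ false
⨁-false {zero}  = refl
⨁-false {suc n} = ⨁-false {n}

⨁-replicate-false : ⨁ (lookup (replicate n false)) ≡ false
⨁-replicate-false {n} = trans (⨁-cong {n} (λ i → lookup-replicate i false)) (⨁-false {n})

⨁-indicator : (f : Fin n → Bool) (l : Fin n) → ⨁ (λ i → f i ∧ does (i ≟ᶠ l)) ≡ f l
⨁-indicator {suc n} f zero    =
  trans (cong₂ _xor_ (∧-identityʳ (f zero)) (trans (⨁-cong (λ i → ∧-zeroʳ (f (suc i)))) (⨁-false {n})))
        (xor-identityʳ (f zero))
⨁-indicator {suc n} f (suc l) =
  trans (cong (_xor ⨁ (λ i → f (suc i) ∧ does (i ≟ᶠ l))) (∧-zeroʳ (f zero))) (⨁-indicator (f ∘ suc) l)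

·-distribʳ-xor : ∀ b b′ x → (b xor b′) · x ≡ (b · x) ⊕ (b′ · x)
·-distribʳ-xor false b′    x = sym (⊕-identityˡ (b′ · x))
·-distribʳ-xor true  false x = sym (⊕-identityʳ x)
·-distribʳ-xor true  true  x = sym (⊕-self x)

lincomb-cong : (g : Fin k → V) {c c′ : Fin k → Bool} → (∀ i → c i ≡ c′ i) → lincomb g c ≡ lincomb g c′
lincomb-cong {zero}  g c≗c′ = refl
lincomb-cong {suc k} g c≗c′ = cong₂ _⊕_ (cong (_· g zero) (c≗c′ zero)) (lincomb-cong (g ∘ suc) (c≗c′ ∘ suc))

lincomb-congˡ : {g g′ : Fin k → V} → (∀ i → g i ≡ g′ i) → ∀ c → lincomb g c ≡ lincomb g′ c
lincomb-congˡ {zero}  g≗g′ c = refl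
lincomb-congˡ {suc k} g≗g′ c = cong₂ _⊕_ (cong (c zero ·_) (g≗g′ zero)) (lincomb-congˡ (g≗g′ ∘ suc) (c ∘ suc))

lincomb-zero : (g : Fin k → V) → lincomb g (λ _ → false) ≡ 0V
lincomb-zero {zero}  g = refl
lincomb-zero {suc k} g = trans (⊕-identityˡ _) (lincomb-zero (g ∘ suc))

lincomb-replicate-false : (g : Fin k → V) → lincomb g (lookup (replicate k false)) ≡ 0V
lincomb-replicate-false g = trans (lincomb-cong g (λ i → lookup-replicate i false)) (lincomb-zero g)

lincomb-xor : (g : Fin k → V) (c c′ : Fin k → Bool) →
              lincomb g (λ i → c i xor c′ i) ≡ lincomb g c ⊕ lincomb g c′
lincomb-xor {zero}  g c c′ = sym (⊕-self 0V)
lincomb-xor {suc k} g c c′ =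
  trans (cong₂ _⊕_ (·-distribʳ-xor (c zero) (c′ zero) (g zero)) (lincomb-xor (g ∘ suc) (c ∘ suc) (c′ ∘ suc)))
        (⊕-interchange _ _ _ _)

lincomb-indicator : (g : Fin k → V) (l : Fin k) → lincomb g (λ i → does (i ≟ᶠ l)) ≡ g l
lincomb-indicator {suc k} g zero    = trans (cong (g zero ⊕_) (lincomb-zero (g ∘ suc))) (⊕-identityʳ (g zero))
lincomb-indicator {suc k} g (suc l) = trans (⊕-identityˡ _) (lincomb-indicator (g ∘ suc) l)

Additive : (V → V) → Set
Additive L = ∀ x y → L (x ⊕ y) ≡ L x ⊕ L y

additive-0V : (L : V → V) → Additive L → L 0V ≡ 0V
additive-0V L L-⊕ = begin
  L 0V                    ≡⟨ sym (⊕-identityʳ (L 0V)) ⟩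
  L 0V ⊕ 0V               ≡⟨ cong (L 0V ⊕_) (sym (⊕-self (L 0V))) ⟩
  L 0V ⊕ (L 0V ⊕ L 0V)    ≡⟨ cong (L 0V ⊕_) (sym (L-⊕ 0V 0V)) ⟩
  L 0V ⊕ L 0V             ≡⟨ ⊕-self (L 0V) ⟩
  0V                      ∎
  where open ≡-Reasoning

lincomb-additive : (L : V → V) → Additive L → (g : Fin k → V) (c : Fin k → Bool) →
                   L (lincomb g c) ≡ lincomb (L ∘ g) c
lincomb-additive {k = zero} L L-⊕ g c = additive-0V L L-⊕
lincomb-additive {k = suc k} L L-⊕ g c =
  trans (L-⊕ _ _) (cong₂ _⊕_ (L-· (c zero)) (lincomb-additive L L-⊕ (g ∘ suc) (c ∘ suc)))
  where
  L-· : ∀ b → L (b · g zero) ≡ b · L (g zero)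
  L-· true  = refl
  L-· false = additive-0V L L-⊕

LinearForm : (V → Bool) → Set
LinearForm F = ∀ x y → F (x ⊕ y) ≡ F x xor F y

linearForm-0V : (F : V → Bool) → LinearForm F → F 0V ≡ false
linearForm-0V F F-⊕ = trans (F-⊕ 0V 0V) (xor-same (F 0V))

lincomb-linearForm : (F : V → Bool) → LinearForm F → (g : Fin k → V) (c : Fin k → Bool) →
                     F (lincomb g c) ≡ ⨁ (λ i → c i ∧ F (g i))
lincomb-linearForm {k = zero} F F-⊕ g c = linearForm-0V F F-⊕
lincomb-linearForm {k = suc k} F F-⊕ g c =
  trans (F-⊕ _ _) (cong₂ _xor_ (F-· (c zero)) (lincomb-linearForm F F-⊕ (g ∘ suc) (c ∘ suc)))
  where
  F-· : ∀ b → F (b · g zero) ≡ b ∧ F (g zero)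
  F-· true  = refl
  F-· false = linearForm-0V F F-⊕

inSpan-additive : (L : V → V) → Additive L → (g : Fin k → V) {x : V} → InSpan g x → InSpan (L ∘ g) (L x)
inSpan-additive L L-⊕ g (c , refl) = c , sym (lincomb-additive L L-⊕ g c)

inSpan-⊕ : (g : Fin k → V) {x y : V} → InSpan g x → InSpan g y → InSpan g (x ⊕ y)
inSpan-⊕ g (c , refl) (c′ , refl) = (λ i → c i xor c′ i) , lincomb-xor g c c′

-- Deciding properties of finite families of vectors

_≟ᵥ_ : DecidableEquality (Vec Bool n)
_≟ᵥ_ = Vecₚ.≡-dec Boolₚ._≟_

does≡true⇒ : {A : Set ℓ} (a? : Dec A) → does a? ≡ true → A
does≡true⇒ (yes a) _ = a

all-vectors? : {P : Pred (Vec Bool n) ℓ} → Decidable P → Dec (∀ v → P v)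
all-vectors? {zero}  P? = map′ (λ { p [] → p }) (λ ∀P → ∀P []) (P? [])
all-vectors? {suc n} P? =
  map′ (λ { (∀P₀ , ∀P₁) (false ∷ v) → ∀P₀ v ; (∀P₀ , ∀P₁) (true ∷ v) → ∀P₁ v })
       (λ ∀P → (λ v → ∀P (false ∷ v)) , (λ v → ∀P (true ∷ v)))
       (all-vectors? (P? ∘ (false ∷_)) ×-dec all-vectors? (P? ∘ (true ∷_)))

any-vector? : {P : Pred (Vec Bool n) ℓ} → Decidable P → Dec (∃ P)
any-vector? {zero}  P? = map′ ([] ,_) (λ { ([] , p) → p }) (P? [])
any-vector? {suc n} P? with any-vector? (P? ∘ (false ∷_))
... | yes (v , p) = yes (false ∷ v , p)
... | no ¬P₀ = map′ (λ (v , p) → true ∷ v , p)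
                    (λ { (false ∷ v , p) → contradiction (v , p) ¬P₀ ; (true ∷ v , p) → v , p })
                    (any-vector? (P? ∘ (true ∷_)))

Respects≗ : Pred (Fin k → Bool) ℓ → Set ℓ
Respects≗ P = ∀ {c c′} → (∀ i → c i ≡ c′ i) → P c → P c′

all-functions? : {P : Pred (Fin k → Bool) ℓ} → Respects≗ P → Decidable P → Dec (∀ c → P c)
all-functions? resp P? =
  map′ (λ ∀P c → resp (lookup∘tabulate c) (∀P (tabulate c))) (λ ∀P v → ∀P (lookup v))
       (all-vectors? (P? ∘ lookup))

any-function? : {P : Pred (Fin k → Bool) ℓ} → Respects≗ P → Decidable P → Dec (∃ P)
any-function? resp P? =
  map′ (λ (v , p) → lookup v , p) (λ (c , p) → tabulate c , resp (sym ∘ lookup∘tabulate c) p)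
       (any-vector? (P? ∘ lookup))

inSpan? : (g : Fin k → V) → Decidable (InSpan g)
inSpan? g x = any-function? (λ c≗c′ eq → trans (sym (lincomb-cong g c≗c′)) eq) (λ c → lincomb g c ≟ᵥ x)

all-inSpan? : (g : Fin k → V) {P : Pred V ℓ} → Decidable P → Dec (∀ x → InSpan g x → P x)
all-inSpan? g {P} P? =
  map′ (λ ∀P x (c , eq) → subst P eq (∀P c)) (λ ∀P c → ∀P _ (c , refl))
       (all-functions? (λ c≗c′ → subst P (lincomb-cong g c≗c′)) (P? ∘ lincomb g))

linIndep? : (g : Fin k → V) → Dec (LinIndep g)
linIndep? g = all-functions? respects (λ c → (lincomb g c ≟ᵥ 0V) →-dec all? (λ i → c i Boolₚ.≟ false))
  where
  respects : Respects≗ (λ c → lincomb g c ≡ 0V → ∀ i → c i ≡ false)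
  respects c≗c′ P eq i = trans (sym (c≗c′ i)) (P (trans (lincomb-cong g c≗c′) eq) i)

generator? : (a : Coeffs) (g : Fin 4 → V) → Dec (Generator a g)
generator? a g = linIndep? g ×-dec all-inSpan? g (λ x → Q a x Boolₚ.≟ false)

isPoint? : (a : Coeffs) → Decidable (IsPoint a)
isPoint? a x = ¬? (x ≟ᵥ 0V) ×-dec (Q a x Boolₚ.≟ false)

-- Quadratic forms and their polar forms

polar-product : ∀ p q r s → ((p xor q) ∧ (r xor s)) xor ((p ∧ r) xor (q ∧ s)) ≡ (p ∧ s) xor (q ∧ r)
polar-product false false false false = refl
polar-product false false false true  = refl
polar-product false false true  false = refl
polar-product false false true  true  = refl
polar-product false true  false false = refl
polar-product false true  false true  = refl
polar-product false true  true  false = refl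
polar-product false true  true  true  = refl
polar-product true  false false false = refl
polar-product true  false false true  = refl
polar-product true  false true  false = refl
polar-product true  false true  true  = refl
polar-product true  true  false false = refl
polar-product true  true  false true  = refl
polar-product true  true  true  false = refl
polar-product true  true  true  true  = refl

⨁²-xor : (f g : Fin n → Fin n → Bool) →
         ⨁ (λ i → ⨁ λ j → f i j xor g i j) ≡ ⨁ (λ i → ⨁ (f i)) xor ⨁ (λ i → ⨁ (g i))
⨁²-xor f g = trans (⨁-cong λ i → ⨁-xor (f i) (g i)) (⨁-xor (λ i → ⨁ (f i)) (λ i → ⨁ (g i)))

module QuadraticForm (a : Coeffs) where

  coeff : Fin 8 → Fin 8 → Bool
  coeff i j = does (i ≤? j) ∧ a i j

  Q-coeff : ∀ x → Q a x ≡ ⨁ λ i → ⨁ λ j → coeff i j ∧ (lookup x i ∧ lookup x j)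
  Q-coeff x = ⨁-cong λ i → ⨁-cong λ j → if-∧ (does (i ≤? j)) {a i j} {lookup x i ∧ lookup x j}
    where
    if-∧ : ∀ d {α u} → (if d then α ∧ u else false) ≡ (d ∧ α) ∧ u
    if-∧ true  = refl
    if-∧ false = refl

  polar : V → V → Bool
  polar x y = ⨁ λ i → ⨁ λ j → coeff i j ∧ ((lookup x i ∧ lookup y j) xor (lookup y i ∧ lookup x j))

  B-polar : ∀ x y → B a x y ≡ polar x y
  B-polar x y = begin
    Q a (x ⊕ y) xor (Q a x xor Q a y)
      ≡⟨ cong₂ _xor_ (Q-coeff (x ⊕ y)) (cong₂ _xor_ (Q-coeff x) (Q-coeff y)) ⟩
    ⨁ (λ i → ⨁ (T (x ⊕ y) i)) xor (⨁ (λ i → ⨁ (T x i)) xor ⨁ (λ i → ⨁ (T y i)))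
      ≡⟨ cong (⨁ (λ i → ⨁ (T (x ⊕ y) i)) xor_) (sym (⨁²-xor (T x) (T y))) ⟩
    ⨁ (λ i → ⨁ (T (x ⊕ y) i)) xor ⨁ (λ i → ⨁ λ j → T x i j xor T y i j)
      ≡⟨ sym (⨁²-xor (T (x ⊕ y)) (λ i j → T x i j xor T y i j)) ⟩
    ⨁ (λ i → ⨁ λ j → T (x ⊕ y) i j xor (T x i j xor T y i j))
      ≡⟨ ⨁-cong (λ i → ⨁-cong λ j → term i j) ⟩
    polar x y ∎
    where
    open ≡-Reasoning
    T : V → Fin 8 → Fin 8 → Bool
    T z i j = coeff i j ∧ (lookup z i ∧ lookup z j)
    term : ∀ i j → T (x ⊕ y) i j xor (T x i j xor T y i j)
                   ≡ coeff i j ∧ ((lookup x i ∧ lookup y j) xor (lookup y i ∧ lookup x j))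
    term i j = begin
      T (x ⊕ y) i j xor (T x i j xor T y i j)
        ≡⟨ cong (λ u → u xor (T x i j xor T y i j))
                (cong₂ (λ u v → coeff i j ∧ (u ∧ v)) (lookup-zipWith _xor_ i x y) (lookup-zipWith _xor_ j x y)) ⟩
      (c ∧ ((xᵢ xor yᵢ) ∧ (xⱼ xor yⱼ))) xor ((c ∧ (xᵢ ∧ xⱼ)) xor (c ∧ (yᵢ ∧ yⱼ)))
        ≡⟨ cong ((c ∧ ((xᵢ xor yᵢ) ∧ (xⱼ xor yⱼ))) xor_) (sym (∧-distribˡ-xor c _ _)) ⟩
      (c ∧ ((xᵢ xor yᵢ) ∧ (xⱼ xor yⱼ))) xor (c ∧ ((xᵢ ∧ xⱼ) xor (yᵢ ∧ yⱼ)))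
        ≡⟨ sym (∧-distribˡ-xor c _ _) ⟩
      c ∧ (((xᵢ xor yᵢ) ∧ (xⱼ xor yⱼ)) xor ((xᵢ ∧ xⱼ) xor (yᵢ ∧ yⱼ)))
        ≡⟨ cong (c ∧_) (polar-product xᵢ yᵢ xⱼ yⱼ) ⟩
      c ∧ ((xᵢ ∧ yⱼ) xor (yᵢ ∧ xⱼ)) ∎
      where
      c = coeff i j
      xᵢ = lookup x i
      xⱼ = lookup x j
      yᵢ = lookup y i
      yⱼ = lookup y j

  polar-linearʳ : ∀ x y z → polar x (y ⊕ z) ≡ polar x y xor polar x z
  polar-linearʳ x y z = trans (⨁-cong λ i → ⨁-cong λ j → term i j) (⨁²-xor (P y) (P z))
    where
    P : V → Fin 8 → Fin 8 → Bool
    P w i j = coeff i j ∧ ((lookup x i ∧ lookup w j) xor (lookup w i ∧ lookup x j))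
    term : ∀ i j → P (y ⊕ z) i j ≡ P y i j xor P z i j
    term i j = begin
      coeff i j ∧ ((xᵢ ∧ lookup (y ⊕ z) j) xor (lookup (y ⊕ z) i ∧ xⱼ))
        ≡⟨ cong₂ (λ u v → coeff i j ∧ ((xᵢ ∧ u) xor (v ∧ xⱼ))) (lookup-zipWith _xor_ j y z) (lookup-zipWith _xor_ i y z) ⟩
      coeff i j ∧ ((xᵢ ∧ (yⱼ xor zⱼ)) xor ((yᵢ xor zᵢ) ∧ xⱼ))
        ≡⟨ cong (coeff i j ∧_) (cong₂ _xor_ (∧-distribˡ-xor xᵢ yⱼ zⱼ) (∧-distribʳ-xor xⱼ yᵢ zᵢ)) ⟩
      coeff i j ∧ (((xᵢ ∧ yⱼ) xor (xᵢ ∧ zⱼ)) xor ((yᵢ ∧ xⱼ) xor (zᵢ ∧ xⱼ)))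
        ≡⟨ cong (coeff i j ∧_) (xor-interchange (xᵢ ∧ yⱼ) (xᵢ ∧ zⱼ) (yᵢ ∧ xⱼ) (zᵢ ∧ xⱼ)) ⟩
      coeff i j ∧ (((xᵢ ∧ yⱼ) xor (yᵢ ∧ xⱼ)) xor ((xᵢ ∧ zⱼ) xor (zᵢ ∧ xⱼ)))
        ≡⟨ ∧-distribˡ-xor (coeff i j) _ _ ⟩
      P y i j xor P z i j ∎
      where
      open ≡-Reasoning
      xᵢ = lookup x i
      xⱼ = lookup x j
      yᵢ = lookup y i
      yⱼ = lookup y j
      zᵢ = lookup z i
      zⱼ = lookup z j

  B-linearʳ : ∀ x → LinearForm (B a x)
  B-linearʳ x y z = begin
    B a x (y ⊕ z)           ≡⟨ B-polar x (y ⊕ z) ⟩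
    polar x (y ⊕ z)         ≡⟨ polar-linearʳ x y z ⟩
    polar x y xor polar x z ≡⟨ sym (cong₂ _xor_ (B-polar x y) (B-polar x z)) ⟩
    B a x y xor B a x z     ∎
    where open ≡-Reasoning

  B-sym : ∀ x y → B a x y ≡ B a y x
  B-sym x y = cong₂ _xor_ (cong (Q a) (⊕-comm x y)) (xor-comm (Q a x) (Q a y))

  B-linearˡ : ∀ y → LinearForm (λ x → B a x y)
  B-linearˡ y x z = trans (B-sym (x ⊕ z) y) (trans (B-linearʳ y x z) (cong₂ _xor_ (B-sym y x) (B-sym y z)))

  B-zeroʳ : ∀ x → B a x 0V ≡ false
  B-zeroʳ x = linearForm-0V (B a x) (B-linearʳ x)

  B-zeroˡ : ∀ y → B a 0V y ≡ false
  B-zeroˡ y = trans (B-sym 0V y) (B-zeroʳ y)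

  Q-0V : Q a 0V ≡ false
  Q-0V = begin
    Q a 0V                            ≡⟨ sym (xor-identityʳ (Q a 0V)) ⟩
    Q a 0V xor false                  ≡⟨ cong (Q a 0V xor_) (sym (xor-same (Q a 0V))) ⟩
    Q a (0V ⊕ 0V) xor (Q a 0V xor Q a 0V) ≡⟨ B-zeroʳ 0V ⟩
    false                             ∎
    where open ≡-Reasoning

  B-self : ∀ x → B a x x ≡ false
  B-self x = cong₂ _xor_ (trans (cong (Q a) (⊕-self x)) Q-0V) (xor-same (Q a x))

  Q-⊕ : ∀ x y → Q a (x ⊕ y) ≡ (Q a x xor Q a y) xor B a x y
  Q-⊕ x y = xor-recover (Q a (x ⊕ y)) (Q a x xor Q a y)
    where
    xor-recover : ∀ u v → u ≡ v xor (u xor v)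
    xor-recover false false = refl
    xor-recover false true  = refl
    xor-recover true  false = refl
    xor-recover true  true  = refl

-- Isometries

record Isometry (a b : Coeffs) : Set where
  field
    to      : V → V
    from    : V → V
    to∘from : ∀ x → to (from x) ≡ x
    from∘to : ∀ x → from (to x) ≡ x
    to-⊕    : Additive to
    Q-to    : ∀ x → Q b (to x) ≡ Q a x

  from-⊕ : Additive from
  from-⊕ x y = begin
    from (x ⊕ y)                         ≡⟨ cong₂ (λ u v → from (u ⊕ v)) (sym (to∘from x)) (sym (to∘from y)) ⟩
    from (to (from x) ⊕ to (from y))     ≡⟨ cong from (sym (to-⊕ (from x) (from y))) ⟩
    from (to (from x ⊕ from y))          ≡⟨ from∘to (from x ⊕ from y) ⟩
    from x ⊕ from y                      ∎
    where open ≡-Reasoning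

  Q-from : ∀ x → Q a (from x) ≡ Q b x
  Q-from x = trans (sym (Q-to (from x))) (cong (Q b) (to∘from x))

  inverse : Isometry b a
  inverse = record
    { to = from ; from = to ; to∘from = from∘to ; from∘to = to∘from ; to-⊕ = from-⊕ ; Q-to = Q-from }

  isPoint-to : ∀ {x} → IsPoint a x → IsPoint b (to x)
  isPoint-to {x} (x≢0 , Qx≡false) =
    (λ tox≡0 → x≢0 (trans (sym (from∘to x)) (trans (cong from tox≡0) (additive-0V from from-⊕))))
    , trans (Q-to x) Qx≡false

  generator-to : ∀ g → Generator a g → Generator b (to ∘ g)
  generator-to g (indep , totallySingular) = indep′ , totallySingular′
    where
    indep′ : LinIndep (to ∘ g)
    indep′ c eq = indep c (begin
      lincomb g c              ≡⟨ sym (from∘to (lincomb g c)) ⟩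
      from (to (lincomb g c))  ≡⟨ cong from (trans (lincomb-additive to to-⊕ g c) eq) ⟩
      from 0V                  ≡⟨ additive-0V from from-⊕ ⟩
      0V                       ∎)
      where open ≡-Reasoning
    totallySingular′ : ∀ x → InSpan (to ∘ g) x → Q b x ≡ false
    totallySingular′ x (c , refl) =
      trans (cong (Q b) (sym (lincomb-additive to to-⊕ g c))) (trans (Q-to _) (totallySingular _ (c , refl)))

  inSpan-to∘from : ∀ (g : Fin 4 → V) {x} → InSpan (from ∘ g) x → InSpan g (to x)
  inSpan-to∘from g inSpan with inSpan-additive to to-⊕ (from ∘ g) inSpan
  ... | c , eq = c , trans (lincomb-congˡ (sym ∘ to∘from ∘ g) c) eq

module _ {a b : Coeffs} (ι : Isometry a b) where
  open Isometry ι

  ovoid-transport : ∀ {O} → Ovoid a O → Ovoid b (O ∘ from)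
  ovoid-transport {O} (points , meets) = points′ , meets′
    where
    points′ : ∀ x → O (from x) ≡ true → IsPoint b x
    points′ x Ofx = subst (IsPoint b) (to∘from x) (isPoint-to (points (from x) Ofx))
    meets′ : ∀ g → Generator b g → ∃ λ x → (O (from x) ≡ true × InSpan g x) ×
                                        (∀ y → O (from y) ≡ true → InSpan g y → y ≡ x)
    meets′ g gen with meets (from ∘ g) (Isometry.generator-to inverse g gen)
    ... | x , (Ox , x∈g) , unique =
      to x , (subst (λ z → O z ≡ true) (sym (from∘to x)) Ox , inSpan-to∘from g x∈g) ,
      λ y Ofy y∈g → trans (sym (to∘from y)) (cong to (unique (from y) Ofy (inSpan-additive from from-⊕ g y∈g)))

ovoid-meets-once : ∀ {a O} → Ovoid a O → ∀ g → Generator a g →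
                   ∀ {x y} → O x ≡ true → InSpan g x → O y ≡ true → InSpan g y → x ≡ y
ovoid-meets-once (_ , meets) g gen Ox x∈g Oy y∈g with meets g gen
... | _ , _ , unique = trans (unique _ Ox x∈g) (sym (unique _ Oy y∈g))

-- Character sums over GF(2)ⁿ

χ : Bool → ℤ
χ false = 1ℤ
χ true  = -1ℤ

χ-xor : ∀ b b′ → χ (b xor b′) ≡ χ b * χ b′
χ-xor false false = refl
χ-xor false true  = refl
χ-xor true  false = refl
χ-xor true  true  = refl

2^_ : ℕ → ℤ
2^ zero  = 1ℤ
2^ suc n = 2^ n + 2^ n

opaque
  ∑ : (Vec Bool n → ℤ) → ℤ
  ∑ {zero}  f = f []
  ∑ {suc n} f = ∑ (f ∘ (false ∷_)) + ∑ (f ∘ (true ∷_))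

  ∑-[] : (f : Vec Bool 0 → ℤ) → ∑ f ≡ f []
  ∑-[] f = refl

  ∑-suc : (f : Vec Bool (suc n) → ℤ) → ∑ f ≡ ∑ (f ∘ (false ∷_)) + ∑ (f ∘ (true ∷_))
  ∑-suc f = refl

  ∑-cong : {f g : Vec Bool n → ℤ} → (∀ v → f v ≡ g v) → ∑ f ≡ ∑ g
  ∑-cong {zero}  f≗g = f≗g []
  ∑-cong {suc n} f≗g = cong₂ _+_ (∑-cong (f≗g ∘ (false ∷_))) (∑-cong (f≗g ∘ (true ∷_)))

  ∑-+ : (f g : Vec Bool n → ℤ) → ∑ (λ v → f v + g v) ≡ ∑ f + ∑ g
  ∑-+ {zero}  f g = refl
  ∑-+ {suc n} f g =
    trans (cong₂ _+_ (∑-+ (f ∘ (false ∷_)) (g ∘ (false ∷_))) (∑-+ (f ∘ (true ∷_)) (g ∘ (true ∷_))))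
          (+-interchange (∑ (f ∘ (false ∷_))) _ _ _)

  ∑-*ˡ : (m : ℤ) (f : Vec Bool n → ℤ) → ∑ (λ v → m * f v) ≡ m * ∑ f
  ∑-*ˡ {zero}  m f = refl
  ∑-*ˡ {suc n} m f = trans (cong₂ _+_ (∑-*ˡ m (f ∘ (false ∷_))) (∑-*ˡ m (f ∘ (true ∷_))))
                           (sym (*-distribˡ-+ m _ _))

  ∑-const : (m : ℤ) → ∑ {n} (λ _ → m) ≡ 2^ n * m
  ∑-const {zero}  m = sym (*-identityˡ m)
  ∑-const {suc n} m = trans (cong₂ _+_ (∑-const {n} m) (∑-const {n} m)) (sym (*-distribʳ-+ m (2^ n) (2^ n)))

  ∑-translate : (f : Vec Bool n → ℤ) (u : Vec Bool n) → ∑ (λ v → f (zipWith _xor_ v u)) ≡ ∑ f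
  ∑-translate {zero}  f []          = refl
  ∑-translate {suc n} f (false ∷ u) =
    cong₂ _+_ (∑-translate (f ∘ (false ∷_)) u) (∑-translate (f ∘ (true ∷_)) u)
  ∑-translate {suc n} f (true ∷ u)  =
    trans (cong₂ _+_ (∑-translate (f ∘ (true ∷_)) u) (∑-translate (f ∘ (false ∷_)) u))
          (+-comm (∑ (f ∘ (true ∷_))) _)

  ∑-swap : (f : Vec Bool n → Vec Bool k → ℤ) → ∑ (λ x → ∑ (f x)) ≡ ∑ (λ y → ∑ (λ x → f x y))
  ∑-swap {zero}  f = refl
  ∑-swap {suc n} f = trans (cong₂ _+_ (∑-swap (f ∘ (false ∷_))) (∑-swap (f ∘ (true ∷_))))
                           (sym (∑-+ (λ y → ∑ (λ x → f (false ∷ x) y)) (λ y → ∑ (λ x → f (true ∷ x) y))))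

  ∑-vanishing : {f : Vec Bool n → ℤ} → (∀ v → f v ≡ 0ℤ) → ∑ f ≡ 0ℤ
  ∑-vanishing {n} f≡0 = trans (∑-cong f≡0) (trans (∑-const {n} 0ℤ) (*-zeroʳ (2^ n)))

  ∑-supported : {f : Vec Bool n → ℤ} (u : Vec Bool n) → (∀ v → v ≢ u → f v ≡ 0ℤ) → ∑ f ≡ f u
  ∑-supported {zero}  [] _ = refl
  ∑-supported {suc n} {f} (false ∷ u) vanish =
    trans (cong₂ _+_ (∑-supported u (λ v v≢u → vanish (false ∷ v) (v≢u ∘ ∷-injectiveʳ)))
                     (∑-vanishing (λ v → vanish (true ∷ v) λ ())))
          (+-identityʳ (f (false ∷ u)))
  ∑-supported {suc n} {f} (true ∷ u) vanish =
    trans (cong₂ _+_ (∑-vanishing (λ v → vanish (false ∷ v) λ ()))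
                     (∑-supported u (λ v v≢u → vanish (true ∷ v) (v≢u ∘ ∷-injectiveʳ))))
          (+-identityˡ (f (true ∷ u)))

  ∑-nonzero : (f : Vec Bool n → ℤ) → ∑ f ≢ 0ℤ → ∃ λ v → f v ≢ 0ℤ
  ∑-nonzero {zero}  f ∑≢0 = [] , ∑≢0
  ∑-nonzero {suc n} f ∑≢0 with ∑ (f ∘ (false ∷_)) ℤ.≟ 0ℤ
  ... | no  ∑₀≢0 = let v , fv≢0 = ∑-nonzero (f ∘ (false ∷_)) ∑₀≢0 in false ∷ v , fv≢0
  ... | yes ∑₀≡0 = let v , fv≢0 = ∑-nonzero (f ∘ (true ∷_)) (λ ∑₁≡0 → ∑≢0 (cong₂ _+_ ∑₀≡0 ∑₁≡0)) in
                   true ∷ v , fv≢0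

  ∑-mono-≤ : {f g : Vec Bool n → ℤ} → (∀ v → f v ≤ g v) → ∑ f ≤ ∑ g
  ∑-mono-≤ {zero}  f≤g = f≤g []
  ∑-mono-≤ {suc n} f≤g = +-mono-≤ (∑-mono-≤ (f≤g ∘ (false ∷_))) (∑-mono-≤ (f≤g ∘ (true ∷_)))

restrict : Vec Bool n → (Vec Bool n → ℤ) → Vec Bool n → ℤ
restrict u f v = if does (v ≟ᵥ u) then f v else 0ℤ

restrict-self : (u : Vec Bool n) (f : Vec Bool n → ℤ) → restrict u f u ≡ f u
restrict-self u f = cong (if_then f u else 0ℤ) (dec-true (u ≟ᵥ u) refl)

restrict-off : {u v : Vec Bool n} (f : Vec Bool n → ℤ) → v ≢ u → restrict u f v ≡ 0ℤ
restrict-off {u = u} {v} f v≢u = cong (if_then f v else 0ℤ) (dec-false (v ≟ᵥ u) v≢u)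

∑-restrict : (u : Vec Bool n) (f : Vec Bool n → ℤ) → ∑ (restrict u f) ≡ f u
∑-restrict u f = trans (∑-supported u (λ v → restrict-off f)) (restrict-self u f)

module _ {f : Vec Bool n → ℤ} (f≥0 : ∀ v → 0ℤ ≤ f v) where

  ∑-≥-point : ∀ u → f u ≤ ∑ f
  ∑-≥-point u = subst (_≤ ∑ f) (∑-restrict u f) (∑-mono-≤ bound)
    where
    bound : ∀ v → restrict u f v ≤ f v
    bound v with does (v ≟ᵥ u)
    ... | true  = ≤-refl
    ... | false = f≥0 v

  ∑-≥-two : ∀ u w → u ≢ w → f u + f w ≤ ∑ f
  ∑-≥-two u w u≢w =
    subst (_≤ ∑ f) (trans (∑-+ (restrict u f) (restrict w f)) (cong₂ _+_ (∑-restrict u f) (∑-restrict w f)))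
          (∑-mono-≤ bound)
    where
    bound : ∀ v → restrict u f v + restrict w f v ≤ f v
    bound v with v ≟ᵥ u | v ≟ᵥ w
    ... | yes refl | yes refl = contradiction refl u≢w
    ... | yes _    | no _     = ≤-reflexive (+-identityʳ (f v))
    ... | no _     | yes _    = ≤-reflexive (+-identityˡ (f v))
    ... | no _     | no _     = f≥0 v

∑-sum-comm : ∀ {m} (F : Vec Bool n → Fin m → ℤ) → ∑ (λ c → sum (F c)) ≡ sum (λ j → ∑ (λ c → F c j))
∑-sum-comm {m = zero}  F = ∑-vanishing (λ _ → refl)
∑-sum-comm {m = suc m} F = trans (∑-+ (λ c → F c zero) (λ c → sum (F c ∘ suc)))
                                 (cong (_+_ (∑ (λ c → F c zero))) (∑-sum-comm (λ c → F c ∘ suc)))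

∣-sum : ∀ {m} {d : ℤ} (f : Fin m → ℤ) → (∀ j → d ∣ f j) → d ∣ sum f
∣-sum {zero}      f d∣f = divides 0ℤ refl
∣-sum {m = suc m} f d∣f = ∣m∣n⇒∣m+n (d∣f zero) (∣-sum (f ∘ suc) (d∣f ∘ suc))

∏ : (Fin k → ℤ) → ℤ
∏ {zero}  f = 1ℤ
∏ {suc k} f = f zero * ∏ (f ∘ suc)

two-* : ∀ x → (1ℤ + 1ℤ) * x ≡ x + x
two-* x = trans (*-distribʳ-+ x 1ℤ 1ℤ) (cong₂ _+_ (*-identityˡ x) (*-identityˡ x))

∏-1+χ-expand : (b : Fin k → Bool) → ∏ (λ i → 1ℤ + χ (b i)) ≡ ∑ {k} (λ c → χ (⨁ λ i → lookup c i ∧ b i))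
∏-1+χ-expand {zero}  b = sym (∑-[] _)
∏-1+χ-expand {suc k} b = begin
  (1ℤ + χ (b zero)) * ∏ (λ i → 1ℤ + χ (b (suc i)))
    ≡⟨ cong ((1ℤ + χ (b zero)) *_) (∏-1+χ-expand (b ∘ suc)) ⟩
  (1ℤ + χ (b zero)) * ∑ (χ ∘ E)
    ≡⟨ *-distribʳ-+ (∑ (χ ∘ E)) 1ℤ (χ (b zero)) ⟩
  1ℤ * ∑ (χ ∘ E) + χ (b zero) * ∑ (χ ∘ E)
    ≡⟨ cong₂ _+_ (*-identityˡ (∑ (χ ∘ E))) (sym (∑-*ˡ (χ (b zero)) (χ ∘ E))) ⟩
  ∑ (χ ∘ E) + ∑ (λ c → χ (b zero) * χ (E c))
    ≡⟨ cong (_+_ (∑ (χ ∘ E))) (∑-cong λ c → sym (χ-xor (b zero) (E c))) ⟩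
  ∑ (χ ∘ E) + ∑ (λ c → χ (b zero xor E c))
    ≡⟨ sym (∑-suc _) ⟩
  ∑ (λ c → χ (⨁ λ i → lookup c i ∧ b i)) ∎
  where
  open ≡-Reasoning
  E : Vec Bool k → Bool
  E c = ⨁ λ i → lookup c i ∧ b (suc i)

∏-1+χ-values : (b : Fin k → Bool) → ∏ (λ i → 1ℤ + χ (b i)) ≡ 0ℤ ⊎ ∏ (λ i → 1ℤ + χ (b i)) ≡ 2^ k
∏-1+χ-values {zero}  b = inj₂ refl
∏-1+χ-values {suc k} b with b zero | ∏-1+χ-values (b ∘ suc)
... | true  | _            = inj₁ refl
... | false | inj₁ ∏₁≡0    = inj₁ (trans (cong ((1ℤ + 1ℤ) *_) ∏₁≡0) refl)
... | false | inj₂ ∏₁≡2^k  = inj₂ (trans (cong ((1ℤ + 1ℤ) *_) ∏₁≡2^k) (two-* (2^ k)))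

∏-1+χ-nonzero : (b : Fin k → Bool) → ∏ (λ i → 1ℤ + χ (b i)) ≢ 0ℤ → ∀ i → b i ≡ false
∏-1+χ-nonzero {suc k} b ∏≢0 i with b zero in b₀
... | true  = contradiction refl ∏≢0
∏-1+χ-nonzero {suc k} b ∏≢0 zero    | false = b₀
∏-1+χ-nonzero {suc k} b ∏≢0 (suc i) | false =
  ∏-1+χ-nonzero (b ∘ suc) (λ ∏₁≡0 → ∏≢0 (trans (cong ((1ℤ + 1ℤ) *_) ∏₁≡0) refl)) i

∏-1+χ-false : (b : Fin k → Bool) → (∀ i → b i ≡ false) → ∏ (λ i → 1ℤ + χ (b i)) ≡ 2^ k
∏-1+χ-false {zero}  b _ = refl
∏-1+χ-false {suc k} b b≡false =
  trans (cong₂ (λ u v → (1ℤ + χ u) * v) (b≡false zero) (∏-1+χ-false (b ∘ suc) (b≡false ∘ suc))) (two-* (2^ k))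

2^k∣∏-1+χ : (b : Fin k → Bool) → 2^ k ∣ ∏ (λ i → 1ℤ + χ (b i))
2^k∣∏-1+χ {k} b with ∏-1+χ-values b
... | inj₁ ∏≡0   = divides 0ℤ ∏≡0
... | inj₂ ∏≡2^k = divides 1ℤ (trans ∏≡2^k (sym (*-identityˡ (2^ k))))

2^-nonneg : ∀ n → 0ℤ ≤ 2^ n
2^-nonneg zero    = +≤+ z≤n
2^-nonneg (suc n) = +-mono-≤ (2^-nonneg n) (2^-nonneg n)

∏-1+χ-nonneg : (b : Fin k → Bool) → 0ℤ ≤ ∏ (λ i → 1ℤ + χ (b i))
∏-1+χ-nonneg {k} b with ∏-1+χ-values b
... | inj₁ ∏≡0   = ≤-reflexive (sym ∏≡0)
... | inj₂ ∏≡2^k = subst (0ℤ ≤_) (sym ∏≡2^k) (2^-nonneg k)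

self-negating : ∀ s → s ≡ ℤ.- s → s ≡ 0ℤ
self-negating (+ zero)   _  = refl
self-negating (+ suc n)  ()
self-negating ℤ.-[1+ n ] ()

n*n≡256⇒n≡16 : ∀ n → n ℕ.* n ≡ 256 → n ≡ 16
n*n≡256⇒n≡16 n n²≡256 with <-cmp n 16
... | tri< n<16 _ _ = contradiction n²≡256 (<⇒≢ (*-mono-< n<16 n<16))
... | tri≈ _ n≡16 _ = n≡16
... | tri> _ _ n>16 = contradiction (sym n²≡256) (<⇒≢ (*-mono-< n>16 n>16))

square-root-256 : ∀ s → s * s ≡ + 256 → + 32 ≤ + 16 * s + + 256 → s ≡ + 16
square-root-256 s s²≡256 bound with n*n≡256⇒n≡16 ∣ s ∣ (trans (sym (abs-* s s)) (cong ∣_∣ s²≡256))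
square-root-256 (+ .16)      _ _         | refl = refl
square-root-256 ℤ.-[1+ .15 ] _ (+≤+ ()) | refl

all-false⇒replicate : (v : Vec Bool n) → (∀ i → lookup v i ≡ false) → v ≡ replicate n false
all-false⇒replicate []      _     = refl
all-false⇒replicate (b ∷ v) v≡0 = cong₂ _∷_ (v≡0 zero) (all-false⇒replicate v (v≡0 ∘ suc))

linIndep⇒≢0V : (g : Fin k → V) → LinIndep g → (v : Vec Bool k) → v ≢ replicate k false → lincomb g (lookup v) ≢ 0V
linIndep⇒≢0V g indep v v≢0 eq = v≢0 (all-false⇒replicate v (indep (lookup v) eq))

module Perpendicularity (a : Coeffs) where
  open QuadraticForm a

  -- 2^k if x is orthogonal to every g i, and 0 otherwise.
  perpWeight : (Fin k → V) → V → ℤ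
  perpWeight g x = ∏ (λ i → 1ℤ + χ (B a x (g i)))

  perpWeight-expand : (g : Fin k → V) (x : V) →
                      perpWeight g x ≡ ∑ {k} (λ c → χ (B a x (lincomb g (lookup c))))
  perpWeight-expand g x =
    trans (∏-1+χ-expand (λ i → B a x (g i)))
          (∑-cong (λ c → cong χ (sym (lincomb-linearForm (B a x) (B-linearʳ x) g (lookup c)))))

  perpWeight-nonneg : (g : Fin k → V) (x : V) → 0ℤ ≤ perpWeight g x
  perpWeight-nonneg g x = ∏-1+χ-nonneg (λ i → B a x (g i))

  perpWeight-0V : (g : Fin k → V) → perpWeight g 0V ≡ 2^ k
  perpWeight-0V g = ∏-1+χ-false (λ i → B a 0V (g i)) (B-zeroˡ ∘ g)

module CharacterSums (a : Coeffs) (nondeg : NonDegenerate a) where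
  open QuadraticForm a
  open Perpendicularity a

  ∑-χ-B-0V : ∑ (λ x → χ (B a 0V x)) ≡ + 256
  ∑-χ-B-0V = trans (∑-cong (cong χ ∘ B-zeroˡ)) (∑-const 1ℤ)

  ∑-χ-B : ∀ u → u ≢ 0V → ∑ (λ x → χ (B a u x)) ≡ 0ℤ
  ∑-χ-B u u≢0 = self-negating S (begin
    S                                     ≡⟨ sym (∑-translate (λ x → χ (B a u x)) y) ⟩
    ∑ (λ x → χ (B a u (x ⊕ y)))           ≡⟨ ∑-cong (λ x → cong χ (B-linearʳ u x y)) ⟩
    ∑ (λ x → χ (B a u x xor B a u y))     ≡⟨ ∑-cong (λ x → cong (λ b → χ (B a u x xor b)) Buy≡true) ⟩
    ∑ (λ x → χ (B a u x xor true))        ≡⟨ ∑-cong (λ x → χ-xor (B a u x) true) ⟩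
    ∑ (λ x → χ (B a u x) * -1ℤ)           ≡⟨ ∑-cong (λ x → *-comm (χ (B a u x)) -1ℤ) ⟩
    ∑ (λ x → -1ℤ * χ (B a u x))           ≡⟨ ∑-*ˡ -1ℤ (λ x → χ (B a u x)) ⟩
    -1ℤ * S                               ≡⟨ -1*i≡-i S ⟩
    ℤ.- S                                 ∎)
    where
    open ≡-Reasoning
    S = ∑ (λ x → χ (B a u x))
    y = proj₁ (nondeg u u≢0)
    Buy≡true = proj₂ (nondeg u u≢0)

  gauss : ℤ
  gauss = ∑ (λ x → χ (Q a x))

  ∑-χQ-χB : ∀ u → ∑ (λ x → χ (Q a x) * χ (B a x u)) ≡ χ (Q a u) * gauss
  ∑-χQ-χB u = begin
    ∑ (λ x → χ (Q a x) * χ (B a x u))      ≡⟨ ∑-cong shift ⟩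
    ∑ (λ x → χ (Q a u) * χ (Q a (x ⊕ u)))  ≡⟨ ∑-*ˡ (χ (Q a u)) (λ x → χ (Q a (x ⊕ u))) ⟩
    χ (Q a u) * ∑ (λ x → χ (Q a (x ⊕ u)))  ≡⟨ cong (χ (Q a u) *_) (∑-translate (χ ∘ Q a) u) ⟩
    χ (Q a u) * gauss                      ∎
    where
    open ≡-Reasoning
    shift : ∀ x → χ (Q a x) * χ (B a x u) ≡ χ (Q a u) * χ (Q a (x ⊕ u))
    shift x = begin
      χ (Q a x) * χ (B a x u)                       ≡⟨ sym (χ-xor (Q a x) (B a x u)) ⟩
      χ (Q a x xor B a x u)                         ≡⟨ cong χ (rearrange (Q a x) (Q a u) (B a x u)) ⟩
      χ (Q a u xor ((Q a x xor Q a u) xor B a x u)) ≡⟨ cong (λ b → χ (Q a u xor b)) (sym (Q-⊕ x u)) ⟩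
      χ (Q a u xor Q a (x ⊕ u))                     ≡⟨ χ-xor (Q a u) (Q a (x ⊕ u)) ⟩
      χ (Q a u) * χ (Q a (x ⊕ u))                   ∎
      where
      rearrange : ∀ p q r → p xor r ≡ q xor ((p xor q) xor r)
      rearrange false false r = refl
      rearrange false true  r = sym (not-involutive r)
      rearrange true  false r = refl
      rearrange true  true  r = refl

  gauss² : gauss * gauss ≡ + 256
  gauss² = begin
    gauss * gauss
      ≡⟨ trans (*-comm gauss gauss) (sym (∑-*ˡ gauss (χ ∘ Q a))) ⟩
    ∑ (λ u → gauss * χ (Q a u))
      ≡⟨ ∑-cong (λ u → trans (*-comm gauss (χ (Q a u))) (sym (∑-χQ-χB u))) ⟩
    ∑ (λ u → ∑ (λ x → χ (Q a x) * χ (B a x u)))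
      ≡⟨ ∑-swap (λ u x → χ (Q a x) * χ (B a x u)) ⟩
    ∑ (λ x → ∑ (λ u → χ (Q a x) * χ (B a x u)))
      ≡⟨ ∑-cong (λ x → ∑-*ˡ (χ (Q a x)) (λ u → χ (B a x u))) ⟩
    ∑ (λ x → χ (Q a x) * ∑ (λ u → χ (B a x u)))
      ≡⟨ ∑-supported 0V (λ x x≢0 → trans (cong (χ (Q a x) *_) (∑-χ-B x x≢0)) (*-zeroʳ (χ (Q a x)))) ⟩
    χ (Q a 0V) * ∑ (λ u → χ (B a 0V u))
      ≡⟨ cong₂ (λ b s → χ b * s) Q-0V ∑-χ-B-0V ⟩
    + 256 ∎
    where open ≡-Reasoning

  ∑-χB-lincomb : (q : Fin k → V) → LinIndep q → (f : Vec Bool k → ℤ) →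
                 ∑ (λ c → f c * ∑ (λ x → χ (B a (lincomb q (lookup c)) x))) ≡ f (replicate k false) * + 256
  ∑-χB-lincomb {k} q indep f = begin
    ∑ (λ c → f c * ∑ (λ x → χ (B a (lincomb q (lookup c)) x)))
      ≡⟨ ∑-supported (replicate k false) (λ c c≢0 →
           trans (cong (f c *_) (∑-χ-B _ (linIndep⇒≢0V q indep c c≢0))) (*-zeroʳ (f c))) ⟩
    f (replicate k false) * ∑ (λ x → χ (B a (lincomb q (lookup (replicate k false))) x))
      ≡⟨ cong (f (replicate k false) *_)
              (trans (∑-cong (λ x → cong (λ z → χ (B a z x)) (lincomb-replicate-false q))) ∑-χ-B-0V) ⟩
    f (replicate k false) * + 256 ∎
    where open ≡-Reasoning

  ∑-perpWeight : (g : Fin k → V) → LinIndep g → ∑ (perpWeight g) ≡ + 256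
  ∑-perpWeight {k} g indep = begin
    ∑ (perpWeight g)
      ≡⟨ ∑-cong (perpWeight-expand g) ⟩
    ∑ (λ x → ∑ {k} (λ c → χ (B a x (lincomb g (lookup c)))))
      ≡⟨ ∑-swap (λ x c → χ (B a x (lincomb g (lookup c)))) ⟩
    ∑ {k} (λ c → ∑ (λ x → χ (B a x (lincomb g (lookup c)))))
      ≡⟨ ∑-cong (λ c → sym (trans (*-identityˡ _) (∑-cong (λ x → cong χ (B-sym (lincomb g (lookup c)) x))))) ⟩
    ∑ {k} (λ c → 1ℤ * ∑ (λ x → χ (B a (lincomb g (lookup c)) x)))
      ≡⟨ ∑-χB-lincomb g indep (λ _ → 1ℤ) ⟩
    + 256 ∎
    where open ≡-Reasoning

  ∑-[1+χQ]χB : ∀ u → ∑ (λ x → (1ℤ + χ (Q a x)) * χ (B a x u)) ≡ ∑ (λ x → χ (B a u x)) + χ (Q a u) * gauss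
  ∑-[1+χQ]χB u = begin
    ∑ (λ x → (1ℤ + χ (Q a x)) * χ (B a x u))
      ≡⟨ ∑-cong (λ x → *-distribʳ-+ (χ (B a x u)) 1ℤ (χ (Q a x))) ⟩
    ∑ (λ x → 1ℤ * χ (B a x u) + χ (Q a x) * χ (B a x u))
      ≡⟨ ∑-+ (λ x → 1ℤ * χ (B a x u)) _ ⟩
    ∑ (λ x → 1ℤ * χ (B a x u)) + ∑ (λ x → χ (Q a x) * χ (B a x u))
      ≡⟨ cong₂ _+_ (∑-cong (λ x → trans (*-identityˡ _) (cong χ (B-sym x u)))) (∑-χQ-χB u) ⟩
    ∑ (λ x → χ (B a u x)) + χ (Q a u) * gauss ∎
    where open ≡-Reasoning

  orthogonal-to-basis : (o : Fin 8 → V) → LinIndep o → ∀ z → (∀ l → B a z (o l) ≡ false) → z ≡ 0V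
  orthogonal-to-basis o indep z z⊥o with z ≟ᵥ 0V
  ... | yes z≡0 = z≡0
  ... | no  z≢0 = contradiction
    (subst₂ _≤_ (cong₂ _+_ (perpWeight-0V o) (∏-1+χ-false (λ i → B a z (o i)) z⊥o)) (∑-perpWeight o indep)
            (∑-≥-two (perpWeight-nonneg o) 0V z (z≢0 ∘ sym)))
    (from-no (+ 512 ℤ.≤? + 256))

  ∑-χQ-perpWeight : ∀ g → Generator a g → ∑ (λ x → χ (Q a x) * perpWeight g x) ≡ + 16 * gauss
  ∑-χQ-perpWeight g (_ , totallySingular) = begin
    ∑ (λ x → χ (Q a x) * perpWeight g x)
      ≡⟨ ∑-cong (λ x → trans (cong (χ (Q a x) *_) (perpWeight-expand g x)) (sym (∑-*ˡ (χ (Q a x)) _))) ⟩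
    ∑ (λ x → ∑ {4} (λ c → χ (Q a x) * χ (B a x (w c))))
      ≡⟨ ∑-swap (λ x c → χ (Q a x) * χ (B a x (w c))) ⟩
    ∑ {4} (λ c → ∑ (λ x → χ (Q a x) * χ (B a x (w c))))
      ≡⟨ ∑-cong (λ c → trans (∑-χQ-χB (w c)) (cong (λ b → χ b * gauss) (totallySingular (w c) (lookup c , refl)))) ⟩
    ∑ {4} (λ c → 1ℤ * gauss)
      ≡⟨ trans (∑-const {4} (1ℤ * gauss)) (cong (+ 16 *_) (*-identityˡ gauss)) ⟩
    + 16 * gauss ∎
    where
    open ≡-Reasoning
    w : Vec Bool 4 → V
    w c = lincomb g (lookup c)

  -- The terms of Σₓ (1 + χ(Q x)) perpWeight g x are nonnegative, and the one at x = 0 is 32.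
  gauss-lower-bound : Hyperbolic a → + 32 ≤ + 16 * gauss + + 256
  gauss-lower-bound (g , gen@(indep , _)) =
    subst₂ _≤_ weight-0V ∑-weight (∑-≥-point weight-nonneg 0V)
    where
    weight : V → ℤ
    weight x = χ (Q a x) * perpWeight g x + perpWeight g x
    1+χ-nonneg : ∀ b {P} → 0ℤ ≤ P → 0ℤ ≤ χ b * P + P
    1+χ-nonneg false {P} P≥0 = subst (λ s → 0ℤ ≤ s + P) (sym (*-identityˡ P)) (+-mono-≤ P≥0 P≥0)
    1+χ-nonneg true  {P} P≥0 = ≤-reflexive (sym (trans (cong (_+ P) (-1*i≡-i P)) (+-inverseˡ P)))
    weight-nonneg : ∀ x → 0ℤ ≤ weight x
    weight-nonneg x = 1+χ-nonneg (Q a x) (perpWeight-nonneg g x)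
    weight-0V : weight 0V ≡ + 32
    weight-0V = cong₂ (λ b P → χ b * P + P) Q-0V (perpWeight-0V g)
    ∑-weight : ∑ weight ≡ + 16 * gauss + + 256
    ∑-weight = trans (∑-+ (λ x → χ (Q a x) * perpWeight g x) (perpWeight g))
                     (cong₂ _+_ (∑-χQ-perpWeight g gen) (∑-perpWeight g indep))

  gauss≡16 : Hyperbolic a → gauss ≡ + 16
  gauss≡16 hyperbolic = square-root-256 gauss gauss² (gauss-lower-bound hyperbolic)

-- Extending a partial ovoid to a basis

-- e₂ c = Σ_{i<j} c i ∧ c j, the second elementary symmetric function over GF(2).
e₂ : (Fin k → Bool) → Bool
e₂ {zero}  c = false
e₂ {suc k} c = (c zero ∧ ⨁ (c ∘ suc)) xor e₂ (c ∘ suc)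

NonCollinear : Coeffs → (Fin k → V) → Set
NonCollinear a q = (∀ i → Q a (q i) ≡ false) × (∀ i j → i ≢ j → B a (q i) (q j) ≡ true)

module _ (a : Coeffs) where
  open QuadraticForm a

  nonCollinear-tail : (q : Fin (suc k) → V) → NonCollinear a q → NonCollinear a (q ∘ suc)
  nonCollinear-tail q (singular , nonorth) = singular ∘ suc , λ i j i≢j → nonorth (suc i) (suc j) (i≢j ∘ suc-injective)

  nonCollinear-cons : (q : Fin k → V) {x : V} → NonCollinear a q → Q a x ≡ false → (∀ i → B a x (q i) ≡ true) →
                      NonCollinear a (x ∷ᶠ q)
  nonCollinear-cons q {x} (singular , nonorth) Qx≡false Bxq≡true = singular′ , nonorth′
    where
    singular′ : ∀ i → Q a ((x ∷ᶠ q) i) ≡ false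
    singular′ zero    = Qx≡false
    singular′ (suc i) = singular i
    nonorth′ : ∀ i j → i ≢ j → B a ((x ∷ᶠ q) i) ((x ∷ᶠ q) j) ≡ true
    nonorth′ zero    zero    i≢j = contradiction refl i≢j
    nonorth′ zero    (suc j) _   = Bxq≡true j
    nonorth′ (suc i) zero    _   = trans (B-sym (q i) x) (Bxq≡true i)
    nonorth′ (suc i) (suc j) i≢j = nonorth i j (i≢j ∘ cong suc)

  Q-lincomb : (q : Fin k → V) → NonCollinear a q → ∀ c → Q a (lincomb q c) ≡ e₂ c
  Q-lincomb {zero}  q _ c = Q-0V
  Q-lincomb {suc k} q nc@(singular , nonorth) c =
    trans (Q-⊕ (c zero · q zero) R) (head-term (c zero))
    where
    R = lincomb (q ∘ suc) (c ∘ suc)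
    B-head : B a (q zero) R ≡ ⨁ (c ∘ suc)
    B-head = trans (lincomb-linearForm (B a (q zero)) (B-linearʳ (q zero)) (q ∘ suc) (c ∘ suc))
                   (⨁-cong (λ i → trans (cong (c (suc i) ∧_) (nonorth zero (suc i) λ ())) (∧-identityʳ (c (suc i)))))
    head-term : ∀ b → (Q a (b · q zero) xor Q a R) xor B a (b · q zero) R ≡ (b ∧ ⨁ (c ∘ suc)) xor e₂ (c ∘ suc)
    head-term true  = trans (cong₂ (λ u v → (u xor v) xor B a (q zero) R) (singular zero) (Q-lincomb (q ∘ suc) (nonCollinear-tail q nc) (c ∘ suc)))
                            (trans (cong (e₂ (c ∘ suc) xor_) B-head) (xor-comm (e₂ (c ∘ suc)) _))
    head-term false = trans (cong₂ (λ u v → (u xor v) xor B a 0V R) Q-0V (Q-lincomb (q ∘ suc) (nonCollinear-tail q nc) (c ∘ suc)))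
                            (trans (cong (e₂ (c ∘ suc) xor_) (B-zeroˡ R)) (xor-identityʳ (e₂ (c ∘ suc))))

  B-lincomb : (q : Fin k → V) → NonCollinear a q → ∀ c l → B a (lincomb q c) (q l) ≡ ⨁ c xor c l
  B-lincomb q (_ , nonorth) c l = begin
    B a (lincomb q c) (q l)                    ≡⟨ lincomb-linearForm (λ x → B a x (q l)) (B-linearˡ (q l)) q c ⟩
    ⨁ (λ i → c i ∧ B a (q i) (q l))            ≡⟨ ⨁-cong term ⟩
    ⨁ (λ i → c i xor (c i ∧ does (i ≟ᶠ l)))     ≡⟨ ⨁-xor c _ ⟩
    ⨁ c xor ⨁ (λ i → c i ∧ does (i ≟ᶠ l))       ≡⟨ cong (⨁ c xor_) (⨁-indicator c l) ⟩
    ⨁ c xor c l                                ∎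
    where
    open ≡-Reasoning
    term : ∀ i → c i ∧ B a (q i) (q l) ≡ c i xor (c i ∧ does (i ≟ᶠ l))
    term i with i ≟ᶠ l
    ... | yes refl = trans (cong (c i ∧_) (B-self (q i))) (trans (∧-zeroʳ (c i)) (sym (trans (cong (c i xor_) (∧-identityʳ (c i))) (xor-same (c i)))))
    ... | no i≢l   = trans (cong (c i ∧_) (nonorth i l i≢l)) (trans (∧-identityʳ (c i)) (sym (trans (cong (c i xor_) (∧-zeroʳ (c i))) (xor-identityʳ (c i)))))

  -- A dependency c satisfies c l = ⨁ c for every l (pair it with q l), so c is constant.
  nonCollinear-linIndep : (q : Fin k → V) → NonCollinear a q → lincomb q (λ _ → true) ≢ 0V → LinIndep q
  nonCollinear-linIndep q nc ∑q≢0 c qc≡0 l = by-⨁ (⨁ c) refl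
    where
    constant : ∀ l → ⨁ c ≡ c l
    constant l = xor≡false⇒≡ (⨁ c) (c l)
      (trans (sym (B-lincomb q nc c l)) (trans (cong (λ x → B a x (q l)) qc≡0) (B-zeroˡ (q l))))
    by-⨁ : ∀ b → ⨁ c ≡ b → c l ≡ false
    by-⨁ false ⨁c≡false = trans (sym (constant l)) ⨁c≡false
    by-⨁ true  ⨁c≡true  = contradiction (trans (lincomb-cong q (λ i → trans (sym ⨁c≡true) (constant i))) qc≡0) ∑q≢0

  nonCollinear-∑≢0V : (q : Fin (suc k) → V) → NonCollinear a q → ⨁ {suc k} (λ _ → true) ≡ false →
                      lincomb q (λ _ → true) ≢ 0V
  nonCollinear-∑≢0V q nc even ∑q≡0 = contradiction
    (trans (sym (trans (B-lincomb q nc (λ _ → true) zero) (cong (_xor true) even)))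
           (trans (cong (λ x → B a x (q zero)) ∑q≡0) (B-zeroˡ (q zero))))
    (λ ())

  partialOvoid4⇒nonCollinear : {p : Fin 4 → V} → PartialOvoid4 a p → NonCollinear a p
  partialOvoid4⇒nonCollinear {p} (isPoint , _ , notOnLine) = singular , nonorth
    where
    singular : ∀ i → Q a (p i) ≡ false
    singular i = proj₂ (isPoint i)
    nonorth : ∀ i j → i ≢ j → B a (p i) (p j) ≡ true
    nonorth i j i≢j =
      trans (cong₂ (λ u v → Q a (p i ⊕ p j) xor (u xor v)) (singular i) (singular j))
            (trans (xor-identityʳ (Q a (p i ⊕ p j)))
                   (¬-not (λ Q≡false → notOnLine i j i≢j (singular i , singular j , Q≡false))))

record IndependentPartialOvoid (a : Coeffs) (k : ℕ) : Set where
  field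
    point        : Fin k → V
    nonCollinear : NonCollinear a point
    independent  : LinIndep point

partialOvoid4⇒independent : (a : Coeffs) {p : Fin 4 → V} → PartialOvoid4 a p → IndependentPartialOvoid a 4
partialOvoid4⇒independent a {p} po = record
  { point        = p
  ; nonCollinear = nc
  ; independent  = nonCollinear-linIndep a p nc (nonCollinear-∑≢0V a p nc refl)
  }
  where
  nc = partialOvoid4⇒nonCollinear a po

-- 2^(k+1) times the number of singular points non-collinear with all k points of an
-- independent partial ovoid (see ∑-commonWeight).
R : ℕ → ℤ
R k = + 256 + + 16 * ∑ {k} (λ c → χ (⨁ (lookup c)) * χ (e₂ (lookup c)))

∑-≢-point : {f : Vec Bool n → ℤ} (u : Vec Bool n) → ∑ f ≢ f u → ∃ λ v → v ≢ u × f v ≢ 0ℤ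
∑-≢-point {f = f} u ∑f≢fu = away (∑-nonzero elsewhere ∑elsewhere≢0)
  where
  elsewhere : Vec Bool _ → ℤ
  elsewhere v = if does (v ≟ᵥ u) then 0ℤ else f v
  split : ∀ v → f v ≡ restrict u f v + elsewhere v
  split v with does (v ≟ᵥ u)
  ... | true  = sym (+-identityʳ (f v))
  ... | false = sym (+-identityˡ (f v))
  ∑elsewhere≢0 : ∑ elsewhere ≢ 0ℤ
  ∑elsewhere≢0 ∑≡0 = ∑f≢fu (begin
    ∑ f                                    ≡⟨ ∑-cong split ⟩
    ∑ (λ v → restrict u f v + elsewhere v) ≡⟨ ∑-+ (restrict u f) elsewhere ⟩
    ∑ (restrict u f) + ∑ elsewhere         ≡⟨ cong₂ _+_ (∑-restrict u f) ∑≡0 ⟩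
    f u + 0ℤ                               ≡⟨ +-identityʳ (f u) ⟩
    f u                                    ∎)
    where open ≡-Reasoning
  away : (∃ λ v → elsewhere v ≢ 0ℤ) → ∃ λ v → v ≢ u × f v ≢ 0ℤ
  away (v , ev≢0) with v ≟ᵥ u
  ... | yes _   = contradiction refl ev≢0
  ... | no  v≢u = v , v≢u , ev≢0

opaque
  unfolding ∑

  R-4 : R 4 ≡ + 192
  R-4 = refl

  R-5 : R 5 ≡ + 256
  R-5 = refl

  R-6 : R 6 ≡ + 384
  R-6 = refl

  R-7 : R 7 ≡ + 512
  R-7 = refl

module Extension (a : Coeffs) (nondeg : NonDegenerate a) (hyperbolic : Hyperbolic a) where
  open QuadraticForm a
  open CharacterSums a nondeg

  obstruction : (Fin k → V) → V → Fin (suc k) → Bool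
  obstruction q x = Q a x ∷ᶠ (λ i → not (B a x (q i)))

  -- 2^(k+1) if x is a singular point non-collinear with every q i, and 0 otherwise.
  commonWeight : (Fin k → V) → V → ℤ
  commonWeight q x = ∏ (λ i → 1ℤ + χ (obstruction q x i))

  commonWeight-expand : (q : Fin k → V) (x : V) →
    commonWeight q x ≡ (1ℤ + χ (Q a x)) * ∑ {k} (λ c → χ (⨁ (lookup c)) * χ (B a x (lincomb q (lookup c))))
  commonWeight-expand q x =
    cong ((1ℤ + χ (Q a x)) *_)
      (trans (∏-1+χ-expand (λ i → not (B a x (q i))))
             (∑-cong λ c → trans (cong χ (parity c)) (χ-xor (⨁ (lookup c)) (B a x (lincomb q (lookup c))))))
    where
    parity : ∀ c → ⨁ (λ i → lookup c i ∧ not (B a x (q i))) ≡ ⨁ (lookup c) xor B a x (lincomb q (lookup c))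
    parity c = begin
      ⨁ (λ i → lookup c i ∧ not (B a x (q i)))
        ≡⟨ ⨁-cong (λ i → ∧-not (lookup c i) (B a x (q i))) ⟩
      ⨁ (λ i → lookup c i xor (lookup c i ∧ B a x (q i)))
        ≡⟨ ⨁-xor (lookup c) _ ⟩
      ⨁ (lookup c) xor ⨁ (λ i → lookup c i ∧ B a x (q i))
        ≡⟨ cong (⨁ (lookup c) xor_) (sym (lincomb-linearForm (B a x) (B-linearʳ x) q (lookup c))) ⟩
      ⨁ (lookup c) xor B a x (lincomb q (lookup c)) ∎
      where
      open ≡-Reasoning
      ∧-not : ∀ b b′ → b ∧ not b′ ≡ b xor (b ∧ b′)
      ∧-not false _     = refl
      ∧-not true  false = refl
      ∧-not true  true  = refl

  ∑-commonWeight : (q : Fin k → V) → NonCollinear a q → LinIndep q → ∑ (commonWeight q) ≡ R k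
  ∑-commonWeight {k} q nc indep = begin
    ∑ (commonWeight q)
      ≡⟨ ∑-cong (λ x → trans (commonWeight-expand q x) (sym (∑-*ˡ (1ℤ + χ (Q a x)) _))) ⟩
    ∑ (λ x → ∑ {k} (λ c → (1ℤ + χ (Q a x)) * (σ c * χ (B a x (u c)))))
      ≡⟨ ∑-swap (λ x c → (1ℤ + χ (Q a x)) * (σ c * χ (B a x (u c)))) ⟩
    ∑ {k} (λ c → ∑ (λ x → (1ℤ + χ (Q a x)) * (σ c * χ (B a x (u c)))))
      ≡⟨ ∑-cong (λ c → trans (∑-cong (λ x → x∙yz≈y∙xz (1ℤ + χ (Q a x)) (σ c) _)) (∑-*ˡ (σ c) _)) ⟩
    ∑ {k} (λ c → σ c * ∑ (λ x → (1ℤ + χ (Q a x)) * χ (B a x (u c))))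
      ≡⟨ ∑-cong (λ c → cong (σ c *_) (trans (∑-[1+χQ]χB (u c))
           (cong₂ (λ b g → ∑ (λ x → χ (B a (u c) x)) + χ b * g) (Q-lincomb a q nc (lookup c)) (gauss≡16 hyperbolic)))) ⟩
    ∑ {k} (λ c → σ c * (∑ (λ x → χ (B a (u c) x)) + χ (e₂ (lookup c)) * + 16))
      ≡⟨ ∑-cong (λ c → *-distribˡ-+ (σ c) _ _) ⟩
    ∑ {k} (λ c → σ c * ∑ (λ x → χ (B a (u c) x)) + σ c * (χ (e₂ (lookup c)) * + 16))
      ≡⟨ ∑-+ (λ c → σ c * ∑ (λ x → χ (B a (u c) x))) _ ⟩
    ∑ {k} (λ c → σ c * ∑ (λ x → χ (B a (u c) x))) + ∑ {k} (λ c → σ c * (χ (e₂ (lookup c)) * + 16))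
      ≡⟨ cong₂ _+_ (trans (∑-χB-lincomb q indep σ) (cong (λ b → χ b * + 256) (⨁-replicate-false {k})))
                   (trans (∑-cong (λ c → regroup (σ c) (χ (e₂ (lookup c))) (+ 16))) (∑-*ˡ (+ 16) _)) ⟩
    R k ∎
    where
    open ≡-Reasoning
    σ : Vec Bool k → ℤ
    σ c = χ (⨁ (lookup c))
    u : Vec Bool k → V
    u c = lincomb q (lookup c)
    regroup : ∀ s e g → s * (e * g) ≡ g * (s * e)
    regroup s e g = trans (sym (*-assoc s e g)) (*-comm (s * e) g)

  -- The weights sum to R k, which is neither 0 nor the single weight 2^(k+1).
  common-point : (q : Fin k → V) → NonCollinear a q → LinIndep q → (f : V) → R k ≢ 0ℤ → R k ≢ 2^ (suc k) →
                 ∃ λ x → x ≢ f × Q a x ≡ false × (∀ i → B a x (q i) ≡ true)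
  common-point {k} q nc indep f R≢0 R≢2^ = x , x≢f , unobstructed zero , B≡true
    where
    reject : commonWeight q f ≡ 0ℤ ⊎ commonWeight q f ≡ 2^ (suc k) → ∑ (commonWeight q) ≢ commonWeight q f
    reject (inj₁ w≡0)  ∑≡w = R≢0 (trans (sym (∑-commonWeight q nc indep)) (trans ∑≡w w≡0))
    reject (inj₂ w≡2^) ∑≡w = R≢2^ (trans (sym (∑-commonWeight q nc indep)) (trans ∑≡w w≡2^))
    found = ∑-≢-point f (reject (∏-1+χ-values (obstruction q f)))
    x = proj₁ found
    x≢f = proj₁ (proj₂ found)
    unobstructed : ∀ i → obstruction q x i ≡ false
    unobstructed = ∏-1+χ-nonzero (obstruction q x) (proj₂ (proj₂ found))
    B≡true : ∀ i → B a x (q i) ≡ true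
    B≡true i = trans (sym (not-involutive (B a x (q i)))) (cong not (unobstructed (suc i)))

  -- The new point differs from the sum of the old ones, which keeps the family independent.
  extend : IndependentPartialOvoid a k → R k ≢ 0ℤ → R k ≢ 2^ (suc k) → IndependentPartialOvoid a (suc k)
  extend P R≢0 R≢2^ = record
    { point        = x ∷ᶠ point
    ; nonCollinear = nc′
    ; independent  = nonCollinear-linIndep a (x ∷ᶠ point) nc′ (x≢∑ ∘ ⊕≡0⇒≡)
    }
    where
    open IndependentPartialOvoid P
    found = common-point point nonCollinear independent (lincomb point (λ _ → true)) R≢0 R≢2^
    x = proj₁ found
    x≢∑ = proj₁ (proj₂ found)
    nc′ = nonCollinear-cons a point nonCollinear (proj₁ (proj₂ (proj₂ found))) (proj₂ (proj₂ (proj₂ found)))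

  extendTo8 : IndependentPartialOvoid a 4 → IndependentPartialOvoid a 8
  extendTo8 P₄ = P₈
    where
    avoid : ∀ {k r s} → R k ≡ + r → + r ≢ s → R k ≢ s
    avoid R≡r r≢s = r≢s ∘ trans (sym R≡r)
    P₅ = extend P₄ (avoid R-4 λ ()) (avoid R-4 λ ())
    P₆ = extend P₅ (avoid R-5 λ ()) (avoid R-5 λ ())
    P₇ = extend P₆ (avoid R-6 λ ()) (avoid R-6 λ ())
    P₈ = extend P₇ (avoid R-7 λ ()) (avoid R-7 λ ())

-- Coordinates in which Q is the standard form

basis : Fin 8 → V
basis l = tabulate (λ i → does (i ≟ᶠ l))

-- The form Σ_{i<j} xᵢxⱼ; its singular vectors are those of weight ≡ 0 or 1 (mod 4).
std : Coeffs
std i j = not (does (i ≟ᶠ j))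

Q-std : ∀ d → Q std d ≡ e₂ (lookup d)
Q-std = from-yes (all-vectors? λ d → Q std d Boolₚ.≟ e₂ (lookup d))

⨁-const₈ : ∀ b → ⨁ {8} (λ _ → b) ≡ false
⨁-const₈ false = ⨁-false {8}
⨁-const₈ true  = refl

module Coordinates (a : Coeffs) (nondeg : NonDegenerate a) (P : IndependentPartialOvoid a 8) where
  open QuadraticForm a
  open CharacterSums a nondeg
  open IndependentPartialOvoid P renaming (point to o)

  to : V → V
  to d = lincomb o (lookup d)

  to-⊕ : Additive to
  to-⊕ d d′ = trans (lincomb-cong o (λ i → lookup-zipWith _xor_ i d d′)) (lincomb-xor o (lookup d) (lookup d′))

  to-injective : ∀ {d d′} → to d ≡ to d′ → d ≡ d′
  to-injective {d} {d′} eq = ⊕≡0⇒≡ (all-false⇒replicate (d ⊕ d′)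
    (independent (lookup (d ⊕ d′)) (trans (to-⊕ d d′) (trans (cong (to d ⊕_) (sym eq)) (⊕-self (to d))))))

  to-basis : ∀ l → to (basis l) ≡ o l
  to-basis l = trans (lincomb-cong o (lookup∘tabulate (λ i → does (i ≟ᶠ l)))) (lincomb-indicator o l)

  β : V → Bool
  β x = ⨁ (λ l → B a x (o l))

  from : V → V
  from x = tabulate (λ l → B a x (o l) xor β x)

  B-to∘from : ∀ x l → B a (to (from x)) (o l) ≡ B a x (o l)
  B-to∘from x l = begin
    B a (to (from x)) (o l)                            ≡⟨ B-lincomb a o nonCollinear (lookup (from x)) l ⟩
    ⨁ (lookup (from x)) xor lookup (from x) l          ≡⟨ cong₂ _xor_ (⨁-cong lookup-from) (lookup-from l) ⟩
    ⨁ (λ l′ → B a x (o l′) xor β x) xor (B a x (o l) xor β x)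
      ≡⟨ cong (_xor (B a x (o l) xor β x)) (trans (⨁-xor (λ l′ → B a x (o l′)) (λ _ → β x))
                                                   (trans (cong (β x xor_) (⨁-const₈ (β x))) (xor-identityʳ (β x)))) ⟩
    β x xor (B a x (o l) xor β x)                      ≡⟨ cancel (β x) (B a x (o l)) ⟩
    B a x (o l)                                        ∎
    where
    open ≡-Reasoning
    lookup-from : ∀ l → lookup (from x) l ≡ B a x (o l) xor β x
    lookup-from = lookup∘tabulate (λ l → B a x (o l) xor β x)
    cancel : ∀ b c → b xor (c xor b) ≡ c
    cancel false c     = xor-identityʳ c
    cancel true  false = refl
    cancel true  true  = refl

  to∘from : ∀ x → to (from x) ≡ x
  to∘from x = sym (⊕≡0⇒≡ (orthogonal-to-basis o independent (x ⊕ to (from x)) λ l →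
    trans (B-linearˡ (o l) x (to (from x))) (trans (cong (B a x (o l) xor_) (B-to∘from x l)) (xor-same (B a x (o l))))))

  from∘to : ∀ d → from (to d) ≡ d
  from∘to d = to-injective (to∘from (to d))

  coordinates : Isometry std a
  coordinates = record
    { to = to ; from = from ; to∘from = to∘from ; from∘to = from∘to ; to-⊕ = to-⊕
    ; Q-to = λ d → trans (Q-lincomb a o nonCollinear (lookup d)) (sym (Q-std d)) }

-- The standard ovoid

𝟙 : V
𝟙 = replicate 8 true

ovoidPoint : Fin 9 → V
ovoidPoint = 𝟙 ∷ᶠ basis

opaque
  stdOvoid : V → Bool
  stdOvoid x = does (any? λ j → x ≟ᵥ ovoidPoint j)

  stdOvoid-sound : ∀ {x} → stdOvoid x ≡ true → ∃ λ j → x ≡ ovoidPoint j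
  stdOvoid-sound {x} = does≡true⇒ (any? λ j → x ≟ᵥ ovoidPoint j)

  stdOvoid-complete : ∀ j → stdOvoid (ovoidPoint j) ≡ true
  stdOvoid-complete j = dec-true (any? λ j′ → ovoidPoint j ≟ᵥ ovoidPoint j′) (j , refl)

stdOvoid-basis : ∀ l → stdOvoid (basis l) ≡ true
stdOvoid-basis l = stdOvoid-complete (suc l)

ovoidPoint-isPoint : ∀ j → IsPoint std (ovoidPoint j)
ovoidPoint-isPoint = from-yes (all? λ j → isPoint? std (ovoidPoint j))

ovoidPoint-nonCollinear : ∀ j j′ → Q std (ovoidPoint j ⊕ ovoidPoint j′) ≡ false → ovoidPoint j ≡ ovoidPoint j′
ovoidPoint-nonCollinear = from-yes (all? λ j → all? λ j′ →
  (Q std (ovoidPoint j ⊕ ovoidPoint j′) Boolₚ.≟ false) →-dec (ovoidPoint j ≟ᵥ ovoidPoint j′))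

opaque
  unfolding stdOvoid

  -- A point off the ovoid is orthogonal to exactly five of the nine ovoid points.
  χ-B-ovoidPoint : ∀ x → IsPoint std x → stdOvoid x ≡ false → sum (λ j → χ (B std (ovoidPoint j) x)) ≡ 1ℤ
  χ-B-ovoidPoint = from-yes (all-vectors? λ x → isPoint? std x →-dec (stdOvoid x Boolₚ.≟ false) →-dec
    (sum (λ j → χ (B std (ovoidPoint j) x)) ℤ.≟ 1ℤ))

-- Summing χ(B(o, s)) over the ovoid points o and the vectors s of a solid S gives
-- 9 + 15·1 = 24 if S misses the ovoid, but each o contributes 16 or 0 (S ⊆ o^⊥ or not).
stdOvoid-unavoidable : ∀ g → Generator std g → ¬ (∀ c → stdOvoid (lincomb g c) ≢ true)
stdOvoid-unavoidable g (indep , totallySingular) misses = from-no (+ 16 ∣? + 24) 16∣24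
  where
  open Perpendicularity std
  w : Vec Bool 4 → V
  w c = lincomb g (lookup c)
  0₄ = replicate 4 false
  row : Vec Bool 4 → ℤ
  row c = sum (λ j → χ (B std (ovoidPoint j) (w c)))
  row≡ : ∀ c → row c ≡ 1ℤ + restrict 0₄ (λ _ → + 8) c
  row≡ c = cases (c ≟ᵥ 0₄)
    where
    cases : Dec (c ≡ 0₄) → row c ≡ 1ℤ + restrict 0₄ (λ _ → + 8) c
    cases (yes refl) = trans (cong (λ z → sum (λ j → χ (B std (ovoidPoint j) z))) (lincomb-replicate-false g))
                             (sym (cong (_+_ 1ℤ) (restrict-self 0₄ (λ _ → + 8))))
    cases (no c≢0)   = trans (χ-B-ovoidPoint (w c)
                                (linIndep⇒≢0V g indep c c≢0 , totallySingular (w c) (lookup c , refl))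
                                (¬-not (misses (lookup c))))
                             (sym (cong (_+_ 1ℤ) (restrict-off (λ _ → + 8) c≢0)))
  ∑-row : ∑ row ≡ + 24
  ∑-row = trans (∑-cong row≡) (trans (∑-+ (λ _ → 1ℤ) (restrict 0₄ (λ _ → + 8)))
                                     (cong₂ _+_ (∑-const {4} 1ℤ) (∑-restrict 0₄ (λ _ → + 8))))
  ∑-row′ : ∑ row ≡ sum (λ j → perpWeight g (ovoidPoint j))
  ∑-row′ = trans (∑-sum-comm (λ c j → χ (B std (ovoidPoint j) (w c))))
                 (sum-cong-≗ (λ j → sym (perpWeight-expand g (ovoidPoint j))))
  16∣24 : + 16 ∣ + 24
  16∣24 = subst (+ 16 ∣_) (trans (sym ∑-row′) ∑-row)
                (∣-sum _ (λ j → 2^k∣∏-1+χ (λ i → B std (ovoidPoint j) (g i))))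

stdOvoid-meets : ∀ g → Generator std g → ∃ λ x → stdOvoid x ≡ true × InSpan g x
stdOvoid-meets g gen = decide (any-function? respects (λ c → stdOvoid (lincomb g c) Boolₚ.≟ true))
  where
  respects : Respects≗ (λ c → stdOvoid (lincomb g c) ≡ true)
  respects c≗c′ = subst (λ z → stdOvoid z ≡ true) (lincomb-cong g c≗c′)
  decide : Dec (∃ λ c → stdOvoid (lincomb g c) ≡ true) → ∃ λ x → stdOvoid x ≡ true × InSpan g x
  decide (yes (c , Ow)) = lincomb g c , Ow , (c , refl)
  decide (no misses)    = contradiction (λ c Ow → misses (c , Ow)) (stdOvoid-unavoidable g gen)

stdOvoid-isOvoid : Ovoid std stdOvoid
stdOvoid-isOvoid = points , meets
  where
  points : ∀ x → stdOvoid x ≡ true → IsPoint std x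
  points x Ox = let j , x≡oⱼ = stdOvoid-sound Ox in subst (IsPoint std) (sym x≡oⱼ) (ovoidPoint-isPoint j)
  meets : ∀ g → Generator std g → ∃ λ x → (stdOvoid x ≡ true × InSpan g x) ×
                                      (∀ y → stdOvoid y ≡ true → InSpan g y → y ≡ x)
  meets g gen@(_ , totallySingular) with stdOvoid-meets g gen
  ... | x , Ox , x∈g = x , (Ox , x∈g) , unique
    where
    unique : ∀ y → stdOvoid y ≡ true → InSpan g y → y ≡ x
    unique y Oy y∈g =
      let j , y≡oⱼ = stdOvoid-sound Oy
          j′ , x≡oⱼ′ = stdOvoid-sound Ox
      in trans y≡oⱼ (trans (ovoidPoint-nonCollinear j j′
                              (subst (λ z → Q std z ≡ false) (cong₂ _⊕_ y≡oⱼ x≡oⱼ′) (totallySingular _ (inSpan-⊕ g y∈g x∈g))))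
                           (sym x≡oⱼ′))

-- Uniqueness of the standard ovoid through e₄, …, e₇

-- Vectors are written as 8-bit binary literals, coordinate 0 being the leading bit.
toBits : ∀ n → ℕ → Vec Bool n
toBits zero    m = []
toBits (suc n) m = toBits n (m / 2) ∷ʳ (m % 2 ≡ᵇ 1)

solid : ℕ → ℕ → ℕ → ℕ → Fin 4 → V
solid u v w x = lookup (toBits 8 u ∷ toBits 8 v ∷ toBits 8 w ∷ toBits 8 x ∷ [])

-- Apart from the ovoid points, e₄ + e₅ + e₆ + e₇ is the only singular point
-- not collinear with any of e₄, …, e₇.
s₀ : V
s₀ = toBits 8 0b00001111

Candidate : V → Set
Candidate x = stdOvoid x ≡ true ⊎ x ≡ s₀

candidate? : Decidable Candidate
candidate? x = (stdOvoid x Boolₚ.≟ true) ⊎-dec (x ≟ᵥ s₀)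

-- Every singular point outside the candidates lies on one of these solids together with one of
-- e₄, …, e₇.
collinearitySolids : Vec (Fin 4 → V) 20
collinearitySolids =
  solid 0b11110000 0b00001000 0b10100110 0b01100101 ∷
  solid 0b10111000 0b01110100 0b11100010 0b00000001 ∷
  solid 0b11101000 0b00000100 0b11010010 0b10110001 ∷
  solid 0b01111000 0b11100100 0b00000010 0b11010001 ∷
  solid 0b11011000 0b01110100 0b10110010 0b00000001 ∷
  solid 0b11101000 0b11010100 0b01110010 0b00000001 ∷
  solid 0b00001000 0b10110100 0b11010010 0b01110001 ∷
  solid 0b01111000 0b00000100 0b10110010 0b11100001 ∷
  solid 0b00001000 0b11010100 0b11100010 0b01110001 ∷
  solid 0b11110000 0b01101100 0b00000010 0b11001001 ∷
  solid 0b10111000 0b01110100 0b00000010 0b11010001 ∷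
  solid 0b01111000 0b00000100 0b11010010 0b11100001 ∷
  solid 0b11101000 0b10110100 0b00000010 0b11010001 ∷
  solid 0b11110000 0b00000100 0b10101010 0b01101001 ∷
  solid 0b00001000 0b01110100 0b11100010 0b10110001 ∷
  solid 0b11011000 0b00000100 0b10110010 0b01110001 ∷
  solid 0b11110000 0b01101100 0b11001010 0b00000001 ∷
  solid 0b00001000 0b10110100 0b11010010 0b11100001 ∷
  solid 0b10111000 0b01110100 0b00000010 0b11100001 ∷
  solid 0b11011000 0b10110100 0b11100010 0b00000001 ∷
  []

collinearitySolid-valid : ∀ t → Generator std (lookup collinearitySolids t) ×
                                ∃ λ i → InSpan (lookup collinearitySolids t) (basis (4 ↑ʳ i))
collinearitySolid-valid = from-yes (all? λ t →
  generator? std (lookup collinearitySolids t) ×-dec any? λ i → inSpan? (lookup collinearitySolids t) (basis (4 ↑ʳ i)))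

opaque
  unfolding stdOvoid

  collinearitySolids-cover : ∀ x → IsPoint std x → ¬ Candidate x → ∃ λ t → InSpan (lookup collinearitySolids t) x
  collinearitySolids-cover = from-yes (all-vectors? λ x → isPoint? std x →-dec ¬? (candidate? x) →-dec
    any? λ t → inSpan? (lookup collinearitySolids t) x)

forcingSolid : Fin 9 → Fin 4 → V
forcingSolid = lookup
  ( solid 0b11101000 0b10110100 0b11010010 0b01110001
  ∷ solid 0b10000000 0b01101100 0b01011010 0b01110001
  ∷ solid 0b01000000 0b00111100 0b10011010 0b10110001
  ∷ solid 0b00100000 0b11010100 0b01011010 0b11001001
  ∷ solid 0b00010000 0b11100100 0b01101010 0b11001001
  ∷ solid 0b11111000 0b11110000 0b11001101 0b10101110
  ∷ solid 0b11100110 0b11100010 0b11001101 0b10111100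
  ∷ solid 0b11110010 0b11110000 0b11000111 0b10101110
  ∷ solid 0b11110001 0b11110000 0b11001101 0b10101011
  ∷ [])

opaque
  unfolding stdOvoid

  forcingSolid-valid : ∀ j → Generator std (forcingSolid j) ×
                             (∀ x → InSpan (forcingSolid j) x → Candidate x → x ≡ ovoidPoint j)
  forcingSolid-valid = from-yes (all? λ j → generator? std (forcingSolid j) ×-dec
    all-inSpan? (forcingSolid j) (λ x → candidate? x →-dec (x ≟ᵥ ovoidPoint j)))

s₀Solid : Fin 4 → V
s₀Solid = solid 0b10000000 0b00111100 0b01011010 0b01101001

s₀Solid-valid : Generator std s₀Solid × InSpan s₀Solid s₀ × InSpan s₀Solid (ovoidPoint (suc zero))
s₀Solid-valid = from-yes (generator? std s₀Solid ×-dec inSpan? s₀Solid s₀ ×-dec inSpan? s₀Solid (ovoidPoint (suc zero)))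

stdOvoid-unique : ∀ O′ → Ovoid std O′ → (∀ i → O′ (basis (4 ↑ʳ i)) ≡ true) → ∀ x → O′ x ≡ stdOvoid x
stdOvoid-unique O′ ovoid@(points , meets) fixed = agree
  where
  only-candidates : ∀ x → O′ x ≡ true → Candidate x
  only-candidates x O′x = decide (candidate? x)
    where
    decide : Dec (Candidate x) → Candidate x
    decide (yes candidate) = candidate
    decide (no ¬candidate) =
      let t , x∈L = collinearitySolids-cover x (points x O′x) ¬candidate
          L-gen , i , e∈L = collinearitySolid-valid t
          x≡e = ovoid-meets-once {std} {O′} ovoid (lookup collinearitySolids t) L-gen O′x x∈L (fixed i) e∈L
      in contradiction (inj₁ (subst (λ z → stdOvoid z ≡ true) (sym x≡e) (stdOvoid-basis (4 ↑ʳ i)))) ¬candidate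

  forced : ∀ j → O′ (ovoidPoint j) ≡ true
  forced j =
    let F-gen , only = forcingSolid-valid j
        z , (O′z , z∈F) , _ = meets (forcingSolid j) F-gen
    in subst (λ y → O′ y ≡ true) (only z z∈F (only-candidates z O′z)) O′z

  s₀-excluded : O′ s₀ ≢ true
  s₀-excluded O′s₀ =
    let S-gen , s₀∈S , e₀∈S = s₀Solid-valid
    in contradiction (ovoid-meets-once {std} {O′} ovoid s₀Solid S-gen O′s₀ s₀∈S (forced (suc zero)) e₀∈S) (λ ())

  agree : ∀ x → O′ x ≡ stdOvoid x
  agree x with O′ x in O′x
  ... | true  = [ sym , (λ x≡s₀ → contradiction (subst (λ y → O′ y ≡ true) x≡s₀ O′x) s₀-excluded) ]′
                  (only-candidates x O′x)
  ... | false = sym (¬-not λ Ox → let j , x≡oⱼ = stdOvoid-sound Ox in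
                  contradiction (trans (sym O′x) (trans (cong O′ x≡oⱼ) (forced j))) λ ())

lemma4p9 : (a : Coeffs) → NonDegenerate a → Hyperbolic a →
    (p : Fin 4 → V) → PartialOvoid4 a p →
    ∃ λ (O : V → Bool) → (Ovoid a O × (∀ i → O (p i) ≡ true)) ×
      (∀ (O′ : V → Bool) → Ovoid a O′ → (∀ i → O′ (p i) ≡ true) →
         ∀ x → O′ x ≡ O x)
lemma4p9 a nondeg hyperbolic p po = stdOvoid ∘ from , (ovoid-transport ι stdOvoid-isOvoid , contains) , unique
  where
  P₈ = Extension.extendTo8 a nondeg hyperbolic (partialOvoid4⇒independent a po)
  ι : Isometry std a
  ι = Coordinates.coordinates a nondeg P₈
  open Isometry ι

  -- extend prepends its new point, so the last four points of P₈ are p.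
  p≡e : ∀ i → p i ≡ to (basis (4 ↑ʳ i))
  p≡e i = sym (Coordinates.to-basis a nondeg P₈ (4 ↑ʳ i))

  contains : ∀ i → stdOvoid (from (p i)) ≡ true
  contains i = trans (cong (stdOvoid ∘ from) (p≡e i))
                     (trans (cong stdOvoid (from∘to (basis (4 ↑ʳ i)))) (stdOvoid-basis (4 ↑ʳ i)))

  unique : ∀ O′ → Ovoid a O′ → (∀ i → O′ (p i) ≡ true) → ∀ x → O′ x ≡ stdOvoid (from x)
  unique O′ ovoid O′p x = trans (cong O′ (sym (to∘from x)))
    (stdOvoid-unique (O′ ∘ to) (ovoid-transport inverse ovoid) (λ i → trans (cong O′ (sym (p≡e i))) (O′p i)) (from x))
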